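{- Let $m$ be a nonnegative integer and $x$ an indeterminate. Then, as formal power series in $u$ (with coefficients that are polynomials in $x$), \[ \sum_{k=0}^\infty \frac{(x+k)^{m+k}}{k!}e^{ -u(x+k)} u^k = \sum_{k=0}^m\sum_{i=0}^{m-k}\binom{m+k}{i}\left\{ {m+k-i \atop k} \right\}_{\geq 2}\,\frac{x^i u^{k}}{(1-u)^{m+k+1}}. \]
   Context: For integers $n,k\ge 0$, the 2-associated Stirling subset number $\left\{ {n \atop k} \right\}_{\geq 2}$ is the number of partitions of an $n$-element set into $k$ blocks each of which has at least two elements; in particular it is $0$ if $2k>n$, and by convention $\left\{ {0 \atop k} \right\}_{\geq 2}=\delta_{0k}$. Here $e^{ -u(x+k)}$ means $\sum_{\ell\ge0}(-1)^\ell (x+k)^\ell u^\ell/\ell!$ and $(1-u)^{ -N}$ is expanded as a power series in $u$. -}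

module Defs where

open import Data.Bool using (Bool; true; false; _∧_; if_then_else_)
open import Data.Nat as ℕ using (ℕ; zero; suc; _∸_; _!; _≡ᵇ_; _≤ᵇ_)
open import Data.Nat.Properties using (_!≢0)
open import Data.Nat.Combinatorics using (_C_)
open import Data.Integer as ℤ using (ℤ)
open import Data.List using (List; []; _∷_; [_]; map; concatMap; length)
open import Data.Bool.ListAction using (and)
open import Data.Rational using (ℚ; 0ℚ; 1ℚ; _+_; _*_; -_; _/_)

ℕ→ℚ : ℕ → ℚ
ℕ→ℚ n = ℤ.+ n / 1

infixr 8 _^_
_^_ : ℚ → ℕ → ℚ
a ^ zero  = 1ℚ
a ^ suc n = a * (a ^ n)

inv! : ℕ → ℚ
inv! n = ℤ.+ 1 / (n !)
  where instance _ = n !≢0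

Σ≤ : ℕ → (ℕ → ℚ) → ℚ
Σ≤ zero    f = f 0
Σ≤ (suc n) f = Σ≤ n f + f (suc n)

insertions : ℕ → List (List ℕ) → List (List (List ℕ))
insertions a []       = []
insertions a (b ∷ bs) = ((a ∷ b) ∷ bs) ∷ map (b ∷_) (insertions a bs)

-- the list of all set partitions of {0,…,n-1} (each partition is a list of
-- blocks; every partition appears exactly once): element n is either put
-- in a new singleton block or inserted into an existing block.
partitions : ℕ → List (List (List ℕ))
partitions zero    = [ [] ]
partitions (suc n) =
  concatMap (λ p → ((n ∷ []) ∷ p) ∷ insertions n p) (partitions n)

allB : {A : Set} → (A → Bool) → List A → Bool
allB p xs = and (map p xs)

count : {A : Set} → (A → Bool) → List A → ℕ
count p []       = 0
count p (x ∷ xs) = (if p x then 1 else 0) ℕ.+ count p xs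

S≥2 : ℕ → ℕ → ℕ
S≥2 n k = count (λ p → (length p ≡ᵇ k) ∧ allB (λ b → 2 ≤ᵇ length b) p)
                (partitions n)

-- Formal power series in u with rational coefficients (coefficient sequences)

Series : Set
Series = ℕ → ℚ

_⊛_ : Series → Series → Series
(f ⊛ g) n = Σ≤ n (λ i → f i * g (n ∸ i))

_·_ : ℚ → Series → Series
(c · f) n = c * f n

ΣS≤ : ℕ → (ℕ → Series) → Series
ΣS≤ m F n = Σ≤ m (λ k → F k n)

uPow : ℕ → Series
uPow k n = if n ≡ᵇ k then 1ℚ else 0ℚ

-- e^{-u a} = Σ_ℓ (-1)^ℓ a^ℓ u^ℓ / ℓ!
expNeg : ℚ → Series
expNeg a ℓ = ((- 1ℚ) ^ ℓ) * (a ^ ℓ) * inv! ℓ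

-- 1/(1-u) = Σ_n u^n
geom : Series
geom n = 1ℚ

-- (1-u)^{-N} = (1/(1-u))^N
invOneMinusPow : ℕ → Series
invOneMinusPow zero    = uPow 0
invOneMinusPow (suc N) = geom ⊛ invOneMinusPow N

-- Infinite sum Σ_{k≥0} F k of series where F k has u-adic order ≥ k
-- (so the sum converges u-adically): coefficient of u^n is Σ_{k≤n} [u^n] F k.
ΣS∞ : (ℕ → Series) → Series
ΣS∞ F n = Σ≤ n (λ k → F k n)

lhs : ℕ → ℚ → Series
lhs m x = ΣS∞ (λ k →
  (((x + ℕ→ℚ k) ^ (m ℕ.+ k)) * inv! k) · (uPow k ⊛ expNeg (x + ℕ→ℚ k)))

rhs : ℕ → ℚ → Series
rhs m x = ΣS≤ m (λ k → ΣS≤ (m ∸ k) (λ i →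
  (ℕ→ℚ ((m ℕ.+ k) C i) * ℕ→ℚ (S≥2 (m ℕ.+ k ∸ i) k) * (x ^ i))
    · (uPow k ⊛ invOneMinusPow (m ℕ.+ k ℕ.+ 1))))

module Submission where

-- Comparing coefficients of uⁿ, the left side is Σₖ (-1)ⁿ⁻ᵏ (x+k)ᴺ / (k! (n-k)!) with N = m + n, the n-th
-- forward difference of y ↦ yᴺ at x divided by n!.  Both it and Σᵢ C(N,i) xⁱ S(N-i,n), S the Stirling numbers
-- of the second kind, satisfy the Stirling recurrence in (N, n), so they agree.  Counting singleton blocks
-- separately gives S(j,n) = Σₛ C(j,s) S≥2(j-s,n-s).  Reindexing by k = n - s produces the coefficient
-- C(m+n,n-k) = [uⁿ] uᵏ/(1-u)ᵐ⁺ᵏ⁺¹, and the terms with k > m or i > m - k vanish since S≥2(a,k) = 0 for a < 2k.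

open import Defs
open import Data.Bool using (Bool; true; false; T; _∧_; if_then_else_)
open import Data.Bool.Properties using (∧-zeroʳ; ∧-identityʳ; T-∧)
open import Function.Bundles using (module Equivalence)
open import Data.List using (List; []; _∷_; _++_; map; concatMap; length)
open import Data.List.Relation.Unary.All using (All; []; _∷_)
open import Data.List.Relation.Unary.All.Properties using (gmap⁺; concat⁺)
open import Data.Sum using (_⊎_; inj₁; inj₂)
open import Data.Product using (_,_; proj₁; proj₂)
open import Data.Empty using (⊥-elim)
open import Relation.Binary.PropositionalEquality

module Partitions where

  open ≡-Reasoning

  open import Data.Nat using (ℕ; zero; suc; pred; NonZero; _+_; _*_; _∸_; _≤_; _<_; _≡ᵇ_; _≤ᵇ_; s≤s; _!)
  open import Data.Nat.Induction using (<-rec)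
  open import Data.Nat.Properties
  open import Data.Nat.Combinatorics
    using (_C_; nCk+nC[k+1]≡[n+1]C[k+1]; k>n⇒nCk≡0; nC1≡n; nCk≡n!/k![n-k]!; k![n∸k]!∣n!)
  open import Data.Nat.DivMod using (m/n*n≡m)
  open import Data.Nat.Solver using (module +-*-Solver)
  open +-*-Solver using (solve; _:+_; _:*_; _:=_; con)

  Partition : Set
  Partition = List (List ℕ)

  ind : Bool → ℕ
  ind b = if b then 1 else 0

  *-ind-cong : ∀ {m n} b → (T b → m ≡ n) → m * ind b ≡ n * ind b
  *-ind-cong true  m≡n = cong (_* 1) (m≡n _)
  *-ind-cong {m} {n} false _ = trans (*-zeroʳ m) (sym (*-zeroʳ n))

  count-++ : ∀ {A : Set} (P : A → Bool) xs ys → count P (xs ++ ys) ≡ count P xs + count P ys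
  count-++ P []       ys = refl
  count-++ P (x ∷ xs) ys = trans (cong (ind (P x) +_) (count-++ P xs ys)) (sym (+-assoc (ind (P x)) _ _))

  count-map : ∀ {A B : Set} (P : B → Bool) (f : A → B) xs → count P (map f xs) ≡ count (λ x → P (f x)) xs
  count-map P f []       = refl
  count-map P f (x ∷ xs) = cong (ind (P (f x)) +_) (count-map P f xs)

  count-false : ∀ {A : Set} (xs : List A) → count (λ _ → false) xs ≡ 0
  count-false []       = refl
  count-false (x ∷ xs) = count-false xs

  count-cong : ∀ {A : Set} {Q : A → Set} {P P′ : A → Bool} xs → All Q xs →
               (∀ {x} → Q x → P x ≡ P′ x) → count P xs ≡ count P′ xs
  count-cong []       []       P≡P′ = refl
  count-cong (x ∷ xs) (q ∷ qs) P≡P′ = cong₂ (λ b n → ind b + n) (P≡P′ q) (count-cong xs qs P≡P′)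

  count-∧-false : ∀ {A : Set} (P : A → Bool) xs → count (λ x → P x ∧ false) xs ≡ 0
  count-∧-false P []       = refl
  count-∧-false P (x ∷ xs) =
    trans (cong (λ b → ind b + count (λ x → P x ∧ false) xs) (∧-zeroʳ (P x))) (count-∧-false P xs)

  data NonEmpty : List ℕ → Set where
    nonEmpty : ∀ {a b} → NonEmpty (a ∷ b)

  #big #singletons : Partition → ℕ
  #big        = count (λ b → 2 ≤ᵇ length b)
  #singletons = count (λ b → length b ≡ᵇ 1)

  length≡#big+#singletons : ∀ p → All NonEmpty p → length p ≡ #big p + #singletons p
  length≡#big+#singletons []                  []              = refl
  length≡#big+#singletons ((c ∷ []) ∷ bs)     (nonEmpty ∷ ne) =
    trans (cong suc (length≡#big+#singletons bs ne)) (sym (+-suc (#big bs) (#singletons bs)))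
  length≡#big+#singletons ((c ∷ d ∷ e) ∷ bs) (nonEmpty ∷ ne) = cong suc (length≡#big+#singletons bs ne)

  m*f[1+[m∸1]]≡m*f[m] : ∀ m (f : ℕ → ℕ) → m * f (suc (m ∸ 1)) ≡ m * f m
  m*f[1+[m∸1]]≡m*f[m] zero    f = refl
  m*f[1+[m∸1]]≡m*f[m] (suc m) f = refl

  -- Joining a to one of the σ singletons of p changes its shape (#big, #singletons) = (b, σ) into
  -- (b + 1, σ - 1); joining it to one of the b big blocks leaves the shape unchanged.
  count-insertions : ∀ (P : ℕ → ℕ → Bool) a p → All NonEmpty p →
    count (λ q → P (#big q) (#singletons q)) (insertions a p)
      ≡ #singletons p * ind (P (suc (#big p)) (#singletons p ∸ 1))
        + #big p * ind (P (#big p) (#singletons p))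
  count-insertions P a []                  []             = refl
  count-insertions P a ((c ∷ []) ∷ bs)     (nonEmpty ∷ ne) = begin
    ind (P (suc b) σ) + count (λ q → P (#big q) (#singletons q)) (map ((c ∷ []) ∷_) (insertions a bs))
      ≡⟨ cong (ind (P (suc b) σ) +_) (count-map _ ((c ∷ []) ∷_) (insertions a bs)) ⟩
    ind (P (suc b) σ) + count (λ q → P (#big q) (suc (#singletons q))) (insertions a bs)
      ≡⟨ cong (ind (P (suc b) σ) +_) (count-insertions (λ b σ → P b (suc σ)) a bs ne) ⟩
    ind (P (suc b) σ) + (σ * ind (P (suc b) (suc (σ ∸ 1))) + b * ind (P b (suc σ)))
      ≡⟨ cong (λ n → ind (P (suc b) σ) + (n + b * ind (P b (suc σ))))
              (m*f[1+[m∸1]]≡m*f[m] σ (λ σ′ → ind (P (suc b) σ′))) ⟩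
    ind (P (suc b) σ) + (σ * ind (P (suc b) σ) + b * ind (P b (suc σ)))
      ≡⟨ +-assoc (ind (P (suc b) σ)) _ _ ⟨
    suc σ * ind (P (suc b) σ) + b * ind (P b (suc σ)) ∎
    where
    b σ : ℕ
    b = #big bs
    σ = #singletons bs
  count-insertions P a ((c ∷ d ∷ e) ∷ bs) (nonEmpty ∷ ne) = begin
    ind (P (suc b) σ) + count (λ q → P (#big q) (#singletons q)) (map ((c ∷ d ∷ e) ∷_) (insertions a bs))
      ≡⟨ cong (ind (P (suc b) σ) +_) (count-map _ ((c ∷ d ∷ e) ∷_) (insertions a bs)) ⟩
    ind (P (suc b) σ) + count (λ q → P (suc (#big q)) (#singletons q)) (insertions a bs)
      ≡⟨ cong (ind (P (suc b) σ) +_) (count-insertions (λ b σ → P (suc b) σ) a bs ne) ⟩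
    ind (P (suc b) σ) + (σ * ind (P (suc (suc b)) (σ ∸ 1)) + b * ind (P (suc b) σ))
      ≡⟨ solve 4 (λ X Y s b → X :+ (s :* Y :+ b :* X) := s :* Y :+ (con 1 :+ b) :* X) refl
               (ind (P (suc b) σ)) (ind (P (suc (suc b)) (σ ∸ 1))) σ b ⟩
    σ * ind (P (suc (suc b)) (σ ∸ 1)) + suc b * ind (P (suc b) σ) ∎
    where
    b σ : ℕ
    b = #big bs
    σ = #singletons bs

  hasShape : ℕ → ℕ → Partition → Bool
  hasShape t s p = (#big p ≡ᵇ t) ∧ (#singletons p ≡ᵇ s)

  shapeCount : ℕ → ℕ → ℕ → ℕ
  shapeCount j t s = count (hasShape t s) (partitions j)

  extend : ℕ → Partition → List Partition
  extend a p = ((a ∷ []) ∷ p) ∷ insertions a p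

  -- p reaches shape (t, s) when the new element is added as a singleton, resp. joined to a singleton
  addsSingletonTo growsSingletonTo : ℕ → ℕ → Partition → Bool
  addsSingletonTo  t s p = (#big p ≡ᵇ t) ∧ (suc (#singletons p) ≡ᵇ s)
  growsSingletonTo t s p = (suc (#big p) ≡ᵇ t) ∧ (#singletons p ≡ᵇ suc s)

  count-extend : ∀ t s a p → All NonEmpty p →
    count (hasShape t s) (extend a p)
      ≡ ind (addsSingletonTo t s p) + suc s * ind (growsSingletonTo t s p) + t * ind (hasShape t s p)
  count-extend t s a p ne = begin
    ind (addsSingletonTo t s p) + count (hasShape t s) (insertions a p)
      ≡⟨ cong (ind (addsSingletonTo t s p) +_) (count-insertions (λ b σ → (b ≡ᵇ t) ∧ (σ ≡ᵇ s)) a p ne) ⟩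
    ind (addsSingletonTo t s p) + (σ * ind ((suc b ≡ᵇ t) ∧ (σ ∸ 1 ≡ᵇ s)) + b * ind (hasShape t s p))
      ≡⟨ cong₂ (λ x y → ind (addsSingletonTo t s p) + (x + y))
               (grown σ) (*-ind-cong (hasShape t s p) (λ h → ≡ᵇ⇒≡ b t (proj₁ (Equivalence.to T-∧ h)))) ⟩
    ind (addsSingletonTo t s p) + (suc s * ind (growsSingletonTo t s p) + t * ind (hasShape t s p))
      ≡⟨ +-assoc (ind (addsSingletonTo t s p)) _ _ ⟨
    ind (addsSingletonTo t s p) + suc s * ind (growsSingletonTo t s p) + t * ind (hasShape t s p) ∎
    where
    b σ : ℕ
    b = #big p
    σ = #singletons p
    grown : ∀ σ → σ * ind ((suc b ≡ᵇ t) ∧ (σ ∸ 1 ≡ᵇ s)) ≡ suc s * ind ((suc b ≡ᵇ t) ∧ (σ ≡ᵇ suc s))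
    grown zero     = sym (trans (cong (λ c → suc s * ind c) (∧-zeroʳ (suc b ≡ᵇ t))) (*-zeroʳ (suc s)))
    grown (suc σ′) =
      *-ind-cong ((suc b ≡ᵇ t) ∧ (σ′ ≡ᵇ s)) (λ h → cong suc (≡ᵇ⇒≡ σ′ s (proj₂ (Equivalence.to T-∧ h))))

  count-concatMap-extend : ∀ t s a xs → All (All NonEmpty) xs →
    count (hasShape t s) (concatMap (extend a) xs)
      ≡ count (addsSingletonTo t s) xs + suc s * count (growsSingletonTo t s) xs + t * count (hasShape t s) xs
  count-concatMap-extend t s a []       []         = sym (cong₂ _+_ (*-zeroʳ (suc s)) (*-zeroʳ t))
  count-concatMap-extend t s a (p ∷ xs) (ne ∷ nes) = begin
    count (hasShape t s) (extend a p ++ concatMap (extend a) xs)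
      ≡⟨ count-++ (hasShape t s) (extend a p) _ ⟩
    count (hasShape t s) (extend a p) + count (hasShape t s) (concatMap (extend a) xs)
      ≡⟨ cong₂ _+_ (count-extend t s a p ne) (count-concatMap-extend t s a xs nes) ⟩
    (ind (added p) + suc s * ind (grown p) + t * ind (hasShape t s p))
      + (count added xs + suc s * count grown xs + t * count (hasShape t s) xs)
      ≡⟨ solve 8 (λ a g h A G H k t → (a :+ k :* g :+ t :* h) :+ (A :+ k :* G :+ t :* H)
                                     := (a :+ A) :+ k :* (g :+ G) :+ t :* (h :+ H)) refl
               (ind (added p)) (ind (grown p)) (ind (hasShape t s p))
               (count added xs) (count grown xs) (count (hasShape t s) xs) (suc s) t ⟩
    count added (p ∷ xs) + suc s * count grown (p ∷ xs) + t * count (hasShape t s) (p ∷ xs) ∎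
    where
    added grown : Partition → Bool
    added = addsSingletonTo t s
    grown = growsSingletonTo t s

  insertions-nonEmpty : ∀ a p → All NonEmpty p → All (All NonEmpty) (insertions a p)
  insertions-nonEmpty a []       []        = []
  insertions-nonEmpty a (b ∷ p) (nb ∷ ne) = (nonEmpty ∷ ne) ∷ gmap⁺ (nb ∷_) (insertions-nonEmpty a p ne)

  partitions-nonEmpty : ∀ j → All (All NonEmpty) (partitions j)
  partitions-nonEmpty zero    = [] ∷ []
  partitions-nonEmpty (suc j) =
    concat⁺ (gmap⁺ (λ {p} ne → (nonEmpty ∷ ne) ∷ insertions-nonEmpty j p ne) (partitions-nonEmpty j))

  viaNewSingleton : ℕ → ℕ → ℕ → ℕ
  viaNewSingleton j t zero    = 0
  viaNewSingleton j t (suc s) = shapeCount j t s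

  viaJoining : ℕ → ℕ → ℕ → ℕ
  viaJoining j zero    s = 0
  viaJoining j (suc t) s = suc s * shapeCount j t (suc s) + suc t * shapeCount j (suc t) s

  -- The new element j is either a singleton, or joins one of the s + 1 singletons of a partition
  -- of shape (t - 1, s + 1), or joins one of the t big blocks of a partition of shape (t, s).
  shapeCount-suc : ∀ j t s → shapeCount (suc j) t s ≡ viaNewSingleton j t s + viaJoining j t s
  shapeCount-suc j t s = begin
    shapeCount (suc j) t s
      ≡⟨ count-concatMap-extend t s j (partitions j) (partitions-nonEmpty j) ⟩
    count (addsSingletonTo t s) (partitions j) + suc s * count (growsSingletonTo t s) (partitions j)
      + t * shapeCount j t s
      ≡⟨ +-assoc (count (addsSingletonTo t s) (partitions j)) _ _ ⟩
    count (addsSingletonTo t s) (partitions j) + (suc s * count (growsSingletonTo t s) (partitions j)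
      + t * shapeCount j t s)
      ≡⟨ cong₂ _+_ (new s) (joined t) ⟩
    viaNewSingleton j t s + viaJoining j t s ∎
    where
    new : ∀ s → count (addsSingletonTo t s) (partitions j) ≡ viaNewSingleton j t s
    new zero    = count-∧-false (λ p → #big p ≡ᵇ t) (partitions j)
    new (suc s) = refl
    joined : ∀ t → suc s * count (growsSingletonTo t s) (partitions j) + t * shapeCount j t s ≡ viaJoining j t s
    joined zero    = trans (cong (_+ 0) (cong (suc s *_) (count-false (partitions j))))
                           (trans (+-identityʳ (suc s * 0)) (*-zeroʳ (suc s)))
    joined (suc t) = refl

  stirling : ℕ → ℕ → ℕ
  stirling j n = count (λ p → length p ≡ᵇ n) (partitions j)

  count-length-insertions : ∀ a n p → count (λ q → length q ≡ᵇ n) (insertions a p) ≡ n * ind (length p ≡ᵇ n)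
  count-length-insertions a zero    []      = refl
  count-length-insertions a (suc n) []      = sym (*-zeroʳ (suc n))
  count-length-insertions a zero    (b ∷ p) =
    trans (count-map (λ q → length q ≡ᵇ 0) (b ∷_) (insertions a p)) (count-false (insertions a p))
  count-length-insertions a (suc n) (b ∷ p) = cong (ind (length p ≡ᵇ n) +_)
    (trans (count-map (λ q → length q ≡ᵇ suc n) (b ∷_) (insertions a p)) (count-length-insertions a n p))

  count-length-concatMap-extend : ∀ n a xs →
    count (λ q → length q ≡ᵇ n) (concatMap (extend a) xs)
      ≡ count (λ p → suc (length p) ≡ᵇ n) xs + n * count (λ p → length p ≡ᵇ n) xs
  count-length-concatMap-extend n a []       = sym (*-zeroʳ n)
  count-length-concatMap-extend n a (p ∷ xs) = begin
    count (λ q → length q ≡ᵇ n) (extend a p ++ concatMap (extend a) xs)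
      ≡⟨ count-++ (λ q → length q ≡ᵇ n) (extend a p) _ ⟩
    ind (added p) + count (hasLength n) (insertions a p) + count (hasLength n) (concatMap (extend a) xs)
      ≡⟨ cong₂ (λ x y → ind (added p) + x + y) (count-length-insertions a n p) (count-length-concatMap-extend n a xs) ⟩
    ind (added p) + n * ind (hasLength n p) + (count added xs + n * count (hasLength n) xs)
      ≡⟨ solve 5 (λ a b A B n → a :+ n :* b :+ (A :+ n :* B) := (a :+ A) :+ n :* (b :+ B)) refl
               (ind (added p)) (ind (hasLength n p)) (count added xs) (count (hasLength n) xs) n ⟩
    count added (p ∷ xs) + n * count (hasLength n) (p ∷ xs) ∎
    where
    hasLength : ℕ → Partition → Bool
    hasLength n q = length q ≡ᵇ n
    added : Partition → Bool
    added q = suc (length q) ≡ᵇ n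

  stirling-suc-zero : ∀ j → stirling (suc j) 0 ≡ 0
  stirling-suc-zero j =
    trans (count-length-concatMap-extend 0 j (partitions j)) (trans (+-identityʳ _) (count-false (partitions j)))

  stirling-suc : ∀ j n → stirling (suc j) (suc n) ≡ stirling j n + suc n * stirling j (suc n)
  stirling-suc j n = count-length-concatMap-extend (suc n) j (partitions j)

  allBig-hasShape : ∀ t p → All NonEmpty p →
                    ((length p ≡ᵇ t) ∧ allB (λ b → 2 ≤ᵇ length b) p) ≡ hasShape t 0 p
  allBig-hasShape t       []                  []               = refl
  allBig-hasShape t       ((c ∷ []) ∷ bs)     (nonEmpty ∷ _)  =
    trans (∧-zeroʳ (suc (length bs) ≡ᵇ t)) (sym (∧-zeroʳ (#big bs ≡ᵇ t)))
  allBig-hasShape zero    ((c ∷ d ∷ e) ∷ bs) (nonEmpty ∷ _)  = refl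
  allBig-hasShape (suc t) ((c ∷ d ∷ e) ∷ bs) (nonEmpty ∷ ne) = allBig-hasShape t bs ne

  S≥2≡shapeCount : ∀ j t → S≥2 j t ≡ shapeCount j t 0
  S≥2≡shapeCount j t = count-cong (partitions j) (partitions-nonEmpty j) (allBig-hasShape t _)

  [k+1]*nC[k+1]≡[n∸k]*nCk : ∀ n k → suc k * (n C suc k) ≡ (n ∸ k) * (n C k)
  [k+1]*nC[k+1]≡[n∸k]*nCk zero    zero    = refl
  [k+1]*nC[k+1]≡[n∸k]*nCk zero    (suc k) = *-zeroʳ (suc (suc k))
  [k+1]*nC[k+1]≡[n∸k]*nCk (suc n) zero    =
    trans (+-identityʳ (suc n C 1)) (trans (nC1≡n (suc n)) (sym (*-identityʳ (suc n))))
  [k+1]*nC[k+1]≡[n∸k]*nCk (suc n) (suc k) = begin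
    suc (suc k) * (suc n C suc (suc k))
      ≡⟨ cong (suc (suc k) *_) (nCk+nC[k+1]≡[n+1]C[k+1] n (suc k)) ⟨
    suc (suc k) * (n C suc k + n C suc (suc k))
      ≡⟨ *-distribˡ-+ (suc (suc k)) (n C suc k) _ ⟩
    suc (suc k) * (n C suc k) + suc (suc k) * (n C suc (suc k))
      ≡⟨ cong₂ (λ x y → n C suc k + x + y) ([k+1]*nC[k+1]≡[n∸k]*nCk n k)
                                           ([k+1]*nC[k+1]≡[n∸k]*nCk n (suc k)) ⟩
    n C suc k + (n ∸ k) * (n C k) + (n ∸ suc k) * (n C suc k)
      ≡⟨ regroup (≤-<-connex (suc k) n) ⟩
    (n ∸ k) * (n C k + n C suc k)
      ≡⟨ cong ((n ∸ k) *_) (nCk+nC[k+1]≡[n+1]C[k+1] n k) ⟩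
    (n ∸ k) * (suc n C suc k) ∎
    where
    regroup : suc k ≤ n ⊎ n < suc k →
              n C suc k + (n ∸ k) * (n C k) + (n ∸ suc k) * (n C suc k) ≡ (n ∸ k) * (n C k + n C suc k)
    regroup (inj₁ k<n) =
      subst (λ d → n C suc k + d * (n C k) + (n ∸ suc k) * (n C suc k) ≡ d * (n C k + n C suc k))
            (sym (+-∸-assoc 1 k<n))
            (solve 3 (λ X Y D → X :+ (con 1 :+ D) :* Y :+ D :* X := (con 1 :+ D) :* (Y :+ X)) refl
                   (n C suc k) (n C k) (n ∸ suc k))
    regroup (inj₂ n≤k)
      rewrite k>n⇒nCk≡0 n≤k | *-zeroʳ (n ∸ suc k) | +-identityʳ ((n ∸ k) * (n C k)) | +-identityʳ (n C k) = refl

  nCk*k![n∸k]!≡n! : ∀ {n k} → k ≤ n → (n C k) * (k ! * (n ∸ k) !) ≡ n !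
  nCk*k![n∸k]!≡n! {n} {k} k≤n =
    trans (cong (_* (k ! * (n ∸ k) !)) (nCk≡n!/k![n-k]! k≤n)) (m/n*n≡m {{k !* (n ∸ k) !≢0}} (k![n∸k]!∣n! k≤n))

  ∸-comm : ∀ n i s → n ∸ i ∸ s ≡ n ∸ s ∸ i
  ∸-comm n i s = trans (∸-+-assoc n i s) (trans (cong (n ∸_) (+-comm i s)) (sym (∸-+-assoc n s i)))

  nCi*[n∸i]Cs≡nCs*[n∸s]Ci : ∀ n i s → (n C i) * ((n ∸ i) C s) ≡ (n C s) * ((n ∸ s) C i)
  nCi*[n∸i]Cs≡nCs*[n∸s]Ci n i s with ≤-<-connex (i + s) n
  ... | inj₁ i+s≤n = *-cancelʳ-≡ _ _ (i ! * (s ! * (n ∸ i ∸ s) !)) {{denominator≢0}} (begin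
    (n C i) * ((n ∸ i) C s) * (i ! * (s ! * (n ∸ i ∸ s) !))
      ≡⟨ multinomial i s i+s≤n ⟩
    n !
      ≡⟨ multinomial s i (subst (_≤ n) (+-comm i s) i+s≤n) ⟨
    (n C s) * ((n ∸ s) C i) * (s ! * (i ! * (n ∸ s ∸ i) !))
      ≡⟨ cong (λ d → (n C s) * ((n ∸ s) C i) * d)
              (solve 3 (λ a b c → b :* (a :* c) := a :* (b :* c)) refl (i !) (s !) ((n ∸ s ∸ i) !)) ⟩
    (n C s) * ((n ∸ s) C i) * (i ! * (s ! * (n ∸ s ∸ i) !))
      ≡⟨ cong (λ d → (n C s) * ((n ∸ s) C i) * (i ! * (s ! * d !))) (∸-comm n s i) ⟩
    (n C s) * ((n ∸ s) C i) * (i ! * (s ! * (n ∸ i ∸ s) !)) ∎)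
    where
    denominator≢0 : NonZero (i ! * (s ! * (n ∸ i ∸ s) !))
    denominator≢0 = m*n≢0 (i !) _ {{i !≢0}} {{s !* (n ∸ i ∸ s) !≢0}}
    multinomial : ∀ i s → i + s ≤ n → (n C i) * ((n ∸ i) C s) * (i ! * (s ! * (n ∸ i ∸ s) !)) ≡ n !
    multinomial i s i+s≤n = begin
      (n C i) * ((n ∸ i) C s) * (i ! * (s ! * (n ∸ i ∸ s) !))
        ≡⟨ solve 5 (λ a b c d e → a :* b :* (c :* (d :* e)) := a :* (c :* (b :* (d :* e)))) refl
                 (n C i) ((n ∸ i) C s) (i !) (s !) ((n ∸ i ∸ s) !) ⟩
      (n C i) * (i ! * (((n ∸ i) C s) * (s ! * (n ∸ i ∸ s) !)))
        ≡⟨ cong (λ x → (n C i) * (i ! * x)) (nCk*k![n∸k]!≡n! s≤n∸i) ⟩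
      (n C i) * (i ! * (n ∸ i) !)
        ≡⟨ nCk*k![n∸k]!≡n! (≤-trans (m≤m+n i s) i+s≤n) ⟩
      n ! ∎
      where
      s≤n∸i : s ≤ n ∸ i
      s≤n∸i = subst (_≤ n ∸ i) (m+n∸m≡n i s) (∸-monoˡ-≤ i i+s≤n)
  ... | inj₂ n<i+s = trans (vanish i s n<i+s) (sym (vanish s i (subst (n <_) (+-comm i s) n<i+s)))
    where
    vanish : ∀ i s → n < i + s → (n C i) * ((n ∸ i) C s) ≡ 0
    vanish i s n<i+s with ≤-<-connex i n
    ... | inj₁ i≤n = trans (cong ((n C i) *_) (k>n⇒nCk≡0 n∸i<s)) (*-zeroʳ (n C i))
      where
      n∸i<s : n ∸ i < s
      n∸i<s = subst (n ∸ i <_) (m+n∸m≡n i s) (∸-monoˡ-< n<i+s i≤n)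
    ... | inj₂ n<i = cong (_* ((n ∸ i) C s)) (k>n⇒nCk≡0 n<i)

  [1+m+n]∸m≡1+n : ∀ m n → suc (m + n) ∸ m ≡ suc n
  [1+m+n]∸m≡1+n m n = trans (+-∸-assoc 1 (m≤m+n m n)) (cong suc (m+n∸m≡n m n))

  m+k∸i<k+k : ∀ {m k i} → k ≤ m → m ∸ k < i → i ≤ m + k → m + k ∸ i < k + k
  m+k∸i<k+k {m} {k} {i} k≤m m∸k<i i≤m+k = subst (m + k ∸ i <_) m+k∸[m∸k]≡k+k (∸-monoʳ-< m∸k<i i≤m+k)
    where
    m+k∸[m∸k]≡k+k : m + k ∸ (m ∸ k) ≡ k + k
    m+k∸[m∸k]≡k+k = begin
      m + k ∸ (m ∸ k)               ≡⟨ cong (λ l → l + k ∸ (m ∸ k)) (m∸n+n≡m k≤m) ⟨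
      m ∸ k + k + k ∸ (m ∸ k)     ≡⟨ cong (_∸ (m ∸ k)) (+-assoc (m ∸ k) k k) ⟩
      m ∸ k + (k + k) ∸ (m ∸ k)   ≡⟨ m+n∸m≡n (m ∸ k) (k + k) ⟩
      k + k                         ∎

  S≥2-suc-zero : ∀ a → S≥2 (suc a) 0 ≡ 0
  S≥2-suc-zero a = trans (S≥2≡shapeCount (suc a) 0) (shapeCount-suc a 0 0)

  ClosedForm : ℕ → Set
  ClosedForm j = ∀ t s → shapeCount j t s ≡ (j C s) * S≥2 (j ∸ s) t

  S≥2-suc : ∀ a → ClosedForm a → ∀ t → S≥2 (suc a) (suc t) ≡ a * S≥2 (a ∸ 1) t + suc t * S≥2 a (suc t)
  S≥2-suc a cf t = begin
    S≥2 (suc a) (suc t)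
      ≡⟨ S≥2≡shapeCount (suc a) (suc t) ⟩
    shapeCount (suc a) (suc t) 0
      ≡⟨ shapeCount-suc a (suc t) 0 ⟩
    1 * shapeCount a t 1 + suc t * shapeCount a (suc t) 0
      ≡⟨ cong₂ (λ x y → x + suc t * y) (trans (*-identityˡ (shapeCount a t 1)) (cf t 1))
                                       (sym (S≥2≡shapeCount a (suc t))) ⟩
    (a C 1) * S≥2 (a ∸ 1) t + suc t * S≥2 a (suc t)
      ≡⟨ cong (λ c → c * S≥2 (a ∸ 1) t + suc t * S≥2 a (suc t)) (nC1≡n a) ⟩
    a * S≥2 (a ∸ 1) t + suc t * S≥2 a (suc t) ∎

  viaJoining-≤ : ∀ j s t → j ≤ s → ClosedForm j → viaJoining j t (suc s) ≡ (j C suc s) * S≥2 (j ∸ s) t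
  viaJoining-≤ j s zero    j≤s cf = sym (cong (_* S≥2 (j ∸ s) 0) (k>n⇒nCk≡0 (s≤s j≤s)))
  viaJoining-≤ j s (suc t) j≤s cf = begin
    suc (suc s) * shapeCount j t (suc (suc s)) + suc t * shapeCount j (suc t) (suc s)
      ≡⟨ cong₂ (λ x y → suc (suc s) * x + suc t * y) (cf t (suc (suc s))) (cf (suc t) (suc s)) ⟩
    suc (suc s) * ((j C suc (suc s)) * S≥2 (j ∸ suc (suc s)) t) + suc t * ((j C suc s) * S≥2 (j ∸ suc s) (suc t))
      ≡⟨ cong₂ (λ c d → suc (suc s) * (c * S≥2 (j ∸ suc (suc s)) t) + suc t * (d * S≥2 (j ∸ suc s) (suc t)))
               (k>n⇒nCk≡0 (m<n⇒m<1+n (s≤s j≤s))) jC[1+s]≡0 ⟩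
    suc (suc s) * 0 + suc t * 0
      ≡⟨ cong₂ _+_ (*-zeroʳ (suc (suc s))) (*-zeroʳ (suc t)) ⟩
    0
      ≡⟨ cong (_* S≥2 (j ∸ s) (suc t)) jC[1+s]≡0 ⟨
    (j C suc s) * S≥2 (j ∸ s) (suc t) ∎
    where
    jC[1+s]≡0 : j C suc s ≡ 0
    jC[1+s]≡0 = k>n⇒nCk≡0 (s≤s j≤s)

  -- For j = s + 1 + r the two terms recombine by absorption, (s + 2) C(j, s + 2) = r C(j, s + 1), and
  -- the recurrence S≥2-suc at r, which needs the closed form at r < j.
  viaJoining-> : ∀ s r t → (∀ {i} → i ≤ suc (s + r) → ClosedForm i) →
                 viaJoining (suc (s + r)) t (suc s) ≡ (suc (s + r) C suc s) * S≥2 (suc (s + r) ∸ s) t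
  viaJoining-> s r zero    cf = sym (begin
    (suc (s + r) C suc s) * S≥2 (suc (s + r) ∸ s) 0
      ≡⟨ cong (λ a → (suc (s + r) C suc s) * S≥2 a 0) ([1+m+n]∸m≡1+n s r) ⟩
    (suc (s + r) C suc s) * S≥2 (suc r) 0
      ≡⟨ cong ((suc (s + r) C suc s) *_) (S≥2-suc-zero r) ⟩
    (suc (s + r) C suc s) * 0
      ≡⟨ *-zeroʳ (suc (s + r) C suc s) ⟩
    0 ∎)
  viaJoining-> s r (suc t) cf = begin
    suc (suc s) * shapeCount j t (suc (suc s)) + suc t * shapeCount j (suc t) (suc s)
      ≡⟨ cong₂ (λ x y → suc (suc s) * x + suc t * y) (cf ≤-refl t (suc (suc s))) (cf ≤-refl (suc t) (suc s)) ⟩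
    suc (suc s) * ((j C suc (suc s)) * S≥2 (j ∸ suc (suc s)) t) + suc t * (c * S≥2 (j ∸ suc s) (suc t))
      ≡⟨ cong₂ (λ x d → x + suc t * (c * S≥2 d (suc t))) absorb (m+n∸m≡n s r) ⟩
    r * c * S≥2 (r ∸ 1) t + suc t * (c * S≥2 r (suc t))
      ≡⟨ solve 5 (λ r c g u h → r :* c :* g :+ u :* (c :* h) := c :* (r :* g :+ u :* h)) refl
               r c (S≥2 (r ∸ 1) t) (suc t) (S≥2 r (suc t)) ⟩
    c * (r * S≥2 (r ∸ 1) t + suc t * S≥2 r (suc t))
      ≡⟨ cong (c *_) (S≥2-suc r (cf (m≤n+m r (suc s))) t) ⟨
    c * S≥2 (suc r) (suc t)
      ≡⟨ cong (λ a → c * S≥2 a (suc t)) ([1+m+n]∸m≡1+n s r) ⟨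
    c * S≥2 (j ∸ s) (suc t) ∎
    where
    j c : ℕ
    j = suc (s + r)
    c = j C suc s
    j∸[2+s]≡r∸1 : j ∸ suc (suc s) ≡ r ∸ 1
    j∸[2+s]≡r∸1 = trans (sym (pred[m∸n]≡m∸[1+n] (s + r) s))
                        (trans (cong pred (m+n∸m≡n s r)) (pred[m∸n]≡m∸[1+n] r 0))
    absorb : suc (suc s) * ((j C suc (suc s)) * S≥2 (j ∸ suc (suc s)) t) ≡ r * c * S≥2 (r ∸ 1) t
    absorb = begin
      suc (suc s) * ((j C suc (suc s)) * S≥2 (j ∸ suc (suc s)) t)
        ≡⟨ *-assoc (suc (suc s)) (j C suc (suc s)) (S≥2 (j ∸ suc (suc s)) t) ⟨
      suc (suc s) * (j C suc (suc s)) * S≥2 (j ∸ suc (suc s)) t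
        ≡⟨ cong₂ _*_ ([k+1]*nC[k+1]≡[n∸k]*nCk j (suc s)) (cong (λ a → S≥2 a t) j∸[2+s]≡r∸1) ⟩
      (j ∸ suc s) * c * S≥2 (r ∸ 1) t
        ≡⟨ cong (λ d → d * c * S≥2 (r ∸ 1) t) (m+n∸m≡n s r) ⟩
      r * c * S≥2 (r ∸ 1) t ∎

  -- Strong induction: the step at j + 1 uses the closed form at j and, through S≥2-suc, at j - s.
  closedForm : ∀ j → ClosedForm j
  closedForm = <-rec ClosedForm step
    where
    viaJoining-closedForm : ∀ j s t → (∀ {i} → i ≤ j → ClosedForm i) →
                            viaJoining j t (suc s) ≡ (j C suc s) * S≥2 (j ∸ s) t
    viaJoining-closedForm j s t cf with ≤-<-connex j s
    ... | inj₁ j≤s = viaJoining-≤ j s t j≤s (cf ≤-refl)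
    ... | inj₂ s<j with m≤n⇒∃[o]m+o≡n s<j
    ...   | r , refl = viaJoining-> s r t cf
    step : ∀ j → (∀ {i} → i < j → ClosedForm i) → ClosedForm j
    step j       cf t zero    = sym (trans (*-identityˡ (S≥2 j t)) (S≥2≡shapeCount j t))
    step zero    cf t (suc s) = cong (λ b → ind b + 0) (∧-zeroʳ (0 ≡ᵇ t))
    step (suc j) cf t (suc s) = begin
      shapeCount (suc j) t (suc s)
        ≡⟨ shapeCount-suc j t (suc s) ⟩
      shapeCount j t s + viaJoining j t (suc s)
        ≡⟨ cong₂ _+_ (cf ≤-refl t s) (viaJoining-closedForm j s t (λ i≤j → cf (s≤s i≤j))) ⟩
      (j C s) * S≥2 (j ∸ s) t + (j C suc s) * S≥2 (j ∸ s) t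
        ≡⟨ *-distribʳ-+ (S≥2 (j ∸ s) t) (j C s) (j C suc s) ⟨
      (j C s + j C suc s) * S≥2 (j ∸ s) t
        ≡⟨ cong (_* S≥2 (j ∸ s) t) (nCk+nC[k+1]≡[n+1]C[k+1] j s) ⟩
      (suc j C suc s) * S≥2 (suc j ∸ suc s) t ∎

  n<k+k⇒S≥2≡0 : ∀ n k → n < k + k → S≥2 n k ≡ 0
  n<k+k⇒S≥2≡0 zero          (suc k) _  = refl
  n<k+k⇒S≥2≡0 (suc zero)    (suc k) _  = trans (S≥2-suc 0 (closedForm 0) k) (*-zeroʳ (suc k))
  n<k+k⇒S≥2≡0 (suc (suc n)) (suc k) (s≤s 1+n<k+1+k) = begin
    S≥2 (suc (suc n)) (suc k)
      ≡⟨ S≥2-suc (suc n) (closedForm (suc n)) k ⟩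
    suc n * S≥2 n k + suc k * S≥2 (suc n) (suc k)
      ≡⟨ cong₂ (λ x y → suc n * x + suc k * y) (n<k+k⇒S≥2≡0 n k n<k+k)
                                               (n<k+k⇒S≥2≡0 (suc n) (suc k) (m≤n⇒m≤1+n 1+n<k+1+k)) ⟩
    suc n * 0 + suc k * 0
      ≡⟨ cong₂ _+_ (*-zeroʳ (suc n)) (*-zeroʳ (suc k)) ⟩
    0 ∎
    where
    n<k+k : n < k + k
    n<k+k = ≤-pred (subst (suc (suc n) ≤_) (+-suc k k) 1+n<k+1+k)

open Partitions

open import Data.Nat.Base as ℕ using (ℕ; zero; suc; _∸_; _≡ᵇ_; _!; _≤_; _<_; z≤n; s≤s)
import Data.Nat.Properties as ℕ
open import Data.Nat.Combinatorics using (_C_; nCk+nC[k+1]≡[n+1]C[k+1]; k>n⇒nCk≡0; nCn≡1)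
import Data.Integer.Base as ℤ
import Data.Integer.Properties as ℤ
open import Data.Rational.Base using (ℚ; 0ℚ; 1ℚ; _+_; _*_; -_; _/_; toℚᵘ)
import Data.Rational.Properties as ℚ
import Data.Rational.Unnormalised.Base as ℚᵘ
import Data.Rational.Unnormalised.Properties as ℚᵘ
open import Data.Rational.Solver using (module +-*-Solver)
open +-*-Solver

-- ℕ→ℚ n is definitionally fromℚᵘ (mkℚᵘ (+ n) 0), so the homomorphism laws reduce to ℚᵘ.
toℚᵘ-ℕ→ℚ : ∀ n → toℚᵘ (ℕ→ℚ n) ℚᵘ.≃ ℚᵘ.mkℚᵘ (ℤ.+ n) 0
toℚᵘ-ℕ→ℚ n = ℚ.toℚᵘ-fromℚᵘ (ℚᵘ.mkℚᵘ (ℤ.+ n) 0)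

ℕ→ℚ-homo-+ : ∀ a b → ℕ→ℚ (a ℕ.+ b) ≡ ℕ→ℚ a + ℕ→ℚ b
ℕ→ℚ-homo-+ a b = ℚ.toℚᵘ-injective (begin
  toℚᵘ (ℕ→ℚ (a ℕ.+ b))
    ≈⟨ toℚᵘ-ℕ→ℚ (a ℕ.+ b) ⟩
  ℚᵘ.mkℚᵘ (ℤ.+ (a ℕ.+ b)) 0
    ≈⟨ ℚᵘ.*≡* (cong (ℤ._* ℤ.+ 1)
                    (trans (ℤ.pos-+ a b) (sym (cong₂ ℤ._+_ (ℤ.*-identityʳ (ℤ.+ a)) (ℤ.*-identityʳ (ℤ.+ b)))))) ⟩
  ℚᵘ.mkℚᵘ (ℤ.+ a) 0 ℚᵘ.+ ℚᵘ.mkℚᵘ (ℤ.+ b) 0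
    ≈⟨ ℚᵘ.+-cong (toℚᵘ-ℕ→ℚ a) (toℚᵘ-ℕ→ℚ b) ⟨
  toℚᵘ (ℕ→ℚ a) ℚᵘ.+ toℚᵘ (ℕ→ℚ b)
    ≈⟨ ℚ.toℚᵘ-homo-+ (ℕ→ℚ a) (ℕ→ℚ b) ⟨
  toℚᵘ (ℕ→ℚ a + ℕ→ℚ b) ∎)
  where open ℚᵘ.≃-Reasoning

ℕ→ℚ-homo-* : ∀ a b → ℕ→ℚ (a ℕ.* b) ≡ ℕ→ℚ a * ℕ→ℚ b
ℕ→ℚ-homo-* a b = ℚ.toℚᵘ-injective (begin
  toℚᵘ (ℕ→ℚ (a ℕ.* b))
    ≈⟨ toℚᵘ-ℕ→ℚ (a ℕ.* b) ⟩
  ℚᵘ.mkℚᵘ (ℤ.+ (a ℕ.* b)) 0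
    ≈⟨ ℚᵘ.*≡* (trans (ℤ.*-identityʳ (ℤ.+ (a ℕ.* b)))
                      (trans (ℤ.pos-* a b) (sym (ℤ.*-identityʳ (ℤ.+ a ℤ.* ℤ.+ b))))) ⟩
  ℚᵘ.mkℚᵘ (ℤ.+ a) 0 ℚᵘ.* ℚᵘ.mkℚᵘ (ℤ.+ b) 0
    ≈⟨ ℚᵘ.*-cong (toℚᵘ-ℕ→ℚ a) (toℚᵘ-ℕ→ℚ b) ⟨
  toℚᵘ (ℕ→ℚ a) ℚᵘ.* toℚᵘ (ℕ→ℚ b)
    ≈⟨ ℚ.toℚᵘ-homo-* (ℕ→ℚ a) (ℕ→ℚ b) ⟨
  toℚᵘ (ℕ→ℚ a * ℕ→ℚ b) ∎)
  where open ℚᵘ.≃-Reasoning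

1/n*n≡1 : ∀ n .{{_ : ℕ.NonZero n}} → (ℤ.+ 1 / n) * ℕ→ℚ n ≡ 1ℚ
1/n*n≡1 (suc n) = ℚ.toℚᵘ-injective (begin
  toℚᵘ ((ℤ.+ 1 / suc n) * ℕ→ℚ (suc n))
    ≈⟨ ℚ.toℚᵘ-homo-* (ℤ.+ 1 / suc n) (ℕ→ℚ (suc n)) ⟩
  toℚᵘ (ℤ.+ 1 / suc n) ℚᵘ.* toℚᵘ (ℕ→ℚ (suc n))
    ≈⟨ ℚᵘ.*-cong (ℚ.toℚᵘ-fromℚᵘ (ℚᵘ.mkℚᵘ (ℤ.+ 1) n)) (toℚᵘ-ℕ→ℚ (suc n)) ⟩
  ℚᵘ.mkℚᵘ (ℤ.+ 1) n ℚᵘ.* ℚᵘ.mkℚᵘ (ℤ.+ suc n) 0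
    ≈⟨ ℚᵘ.*≡* (cong (λ k → ℤ.+ suc k)
                    (trans (cong (ℕ._* 1) (ℕ.+-identityʳ n)) (sym (ℕ.+-identityʳ (n ℕ.* 1))))) ⟩
  toℚᵘ 1ℚ ∎)
  where open ℚᵘ.≃-Reasoning

open ≡-Reasoning

inv!*n!≡1 : ∀ n → inv! n * ℕ→ℚ (n !) ≡ 1ℚ
inv!*n!≡1 n = 1/n*n≡1 (n !) {{n ℕ.!≢0}}

inv![1+n]*[1+n]≡inv!n : ∀ n → inv! (suc n) * ℕ→ℚ (suc n) ≡ inv! n
inv![1+n]*[1+n]≡inv!n n = begin
  inv! (suc n) * ℕ→ℚ (suc n)
    ≡⟨ ℚ.*-identityʳ _ ⟨
  inv! (suc n) * ℕ→ℚ (suc n) * 1ℚ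
    ≡⟨ cong (inv! (suc n) * ℕ→ℚ (suc n) *_) (trans (ℚ.*-comm (ℕ→ℚ (n !)) (inv! n)) (inv!*n!≡1 n)) ⟨
  inv! (suc n) * ℕ→ℚ (suc n) * (ℕ→ℚ (n !) * inv! n)
    ≡⟨ solve 4 (λ a b c d → a :* b :* (c :* d) := a :* (b :* c) :* d) refl
             (inv! (suc n)) (ℕ→ℚ (suc n)) (ℕ→ℚ (n !)) (inv! n) ⟩
  inv! (suc n) * (ℕ→ℚ (suc n) * ℕ→ℚ (n !)) * inv! n
    ≡⟨ cong (λ q → inv! (suc n) * q * inv! n) (ℕ→ℚ-homo-* (suc n) (n !)) ⟨
  inv! (suc n) * ℕ→ℚ (suc n !) * inv! n
    ≡⟨ cong (_* inv! n) (inv!*n!≡1 (suc n)) ⟩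
  1ℚ * inv! n
    ≡⟨ ℚ.*-identityˡ (inv! n) ⟩
  inv! n ∎

ℕ→ℚ[1+n]*y≡0⇒y≡0 : ∀ n y → ℕ→ℚ (suc n) * y ≡ 0ℚ → y ≡ 0ℚ
ℕ→ℚ[1+n]*y≡0⇒y≡0 n y ny≡0 = begin
  y                                       ≡⟨ ℚ.*-identityˡ y ⟨
  1ℚ * y                                  ≡⟨ cong (_* y) (1/n*n≡1 (suc n)) ⟨
  (ℤ.+ 1 / suc n) * ℕ→ℚ (suc n) * y       ≡⟨ ℚ.*-assoc (ℤ.+ 1 / suc n) (ℕ→ℚ (suc n)) y ⟩
  (ℤ.+ 1 / suc n) * (ℕ→ℚ (suc n) * y)     ≡⟨ cong ((ℤ.+ 1 / suc n) *_) ny≡0 ⟩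
  (ℤ.+ 1 / suc n) * 0ℚ                    ≡⟨ ℚ.*-zeroʳ (ℤ.+ 1 / suc n) ⟩
  0ℚ                                      ∎

ℕ→ℚ-∸ : ∀ {k n} → k ≤ n → ℕ→ℚ n ≡ ℕ→ℚ k + ℕ→ℚ (n ∸ k)
ℕ→ℚ-∸ {k} {n} k≤n = trans (cong ℕ→ℚ (sym (ℕ.m+[n∸m]≡n k≤n))) (ℕ→ℚ-homo-+ k (n ∸ k))

^-+ : ∀ a p r → a ^ (p ℕ.+ r) ≡ a ^ p * a ^ r
^-+ a zero    r = sym (ℚ.*-identityˡ (a ^ r))
^-+ a (suc p) r = trans (cong (a *_) (^-+ a p r)) (sym (ℚ.*-assoc a (a ^ p) (a ^ r)))

Σ≤-cong : ∀ n {f g : ℕ → ℚ} → (∀ {i} → i ≤ n → f i ≡ g i) → Σ≤ n f ≡ Σ≤ n g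
Σ≤-cong zero    f≡g = f≡g z≤n
Σ≤-cong (suc n) f≡g = cong₂ _+_ (Σ≤-cong n (λ i≤n → f≡g (ℕ.m≤n⇒m≤1+n i≤n))) (f≡g ℕ.≤-refl)

Σ≤-zero : ∀ n {f : ℕ → ℚ} → (∀ {i} → i ≤ n → f i ≡ 0ℚ) → Σ≤ n f ≡ 0ℚ
Σ≤-zero n f≡0 = trans (Σ≤-cong n f≡0) (Σ≤-0 n)
  where
  Σ≤-0 : ∀ n → Σ≤ n (λ _ → 0ℚ) ≡ 0ℚ
  Σ≤-0 zero    = refl
  Σ≤-0 (suc n) = cong (_+ 0ℚ) (Σ≤-0 n)

Σ≤-+ : ∀ n (f g : ℕ → ℚ) → Σ≤ n (λ i → f i + g i) ≡ Σ≤ n f + Σ≤ n g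
Σ≤-+ zero    f g = refl
Σ≤-+ (suc n) f g = begin
  Σ≤ n (λ i → f i + g i) + (f (suc n) + g (suc n))
    ≡⟨ cong (_+ (f (suc n) + g (suc n))) (Σ≤-+ n f g) ⟩
  Σ≤ n f + Σ≤ n g + (f (suc n) + g (suc n))
    ≡⟨ solve 4 (λ a b c d → a :+ b :+ (c :+ d) := a :+ c :+ (b :+ d)) refl
             (Σ≤ n f) (Σ≤ n g) (f (suc n)) (g (suc n)) ⟩
  Σ≤ n f + f (suc n) + (Σ≤ n g + g (suc n)) ∎

Σ≤-*ˡ : ∀ n c (f : ℕ → ℚ) → Σ≤ n (λ i → c * f i) ≡ c * Σ≤ n f
Σ≤-*ˡ zero    c f = refl
Σ≤-*ˡ (suc n) c f =
  trans (cong (_+ c * f (suc n)) (Σ≤-*ˡ n c f)) (sym (ℚ.*-distribˡ-+ c (Σ≤ n f) (f (suc n))))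

Σ≤-neg : ∀ n (f : ℕ → ℚ) → Σ≤ n (λ i → - f i) ≡ - Σ≤ n f
Σ≤-neg zero    f = refl
Σ≤-neg (suc n) f =
  trans (cong (_+ - f (suc n)) (Σ≤-neg n f)) (sym (ℚ.neg-distrib-+ (Σ≤ n f) (f (suc n))))

Σ≤-suc : ∀ n (f : ℕ → ℚ) → Σ≤ (suc n) f ≡ f 0 + Σ≤ n (λ i → f (suc i))
Σ≤-suc zero    f = refl
Σ≤-suc (suc n) f = trans (cong (_+ f (suc (suc n))) (Σ≤-suc n f)) (ℚ.+-assoc (f 0) _ _)

Σ≤-swap : ∀ a b (f : ℕ → ℕ → ℚ) →
          Σ≤ a (λ i → Σ≤ b (λ j → f i j)) ≡ Σ≤ b (λ j → Σ≤ a (λ i → f i j))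
Σ≤-swap zero    b f = refl
Σ≤-swap (suc a) b f = trans (cong (_+ Σ≤ b (f (suc a))) (Σ≤-swap a b f))
                            (sym (Σ≤-+ b (λ j → Σ≤ a (λ i → f i j)) (f (suc a))))

Σ≤-reverse : ∀ n (f : ℕ → ℚ) → Σ≤ n f ≡ Σ≤ n (λ i → f (n ∸ i))
Σ≤-reverse zero    f = refl
Σ≤-reverse (suc n) f = begin
  Σ≤ n f + f (suc n)                   ≡⟨ cong (_+ f (suc n)) (Σ≤-reverse n f) ⟩
  Σ≤ n (λ i → f (n ∸ i)) + f (suc n)   ≡⟨ ℚ.+-comm (Σ≤ n (λ i → f (n ∸ i))) (f (suc n)) ⟩
  f (suc n) + Σ≤ n (λ i → f (n ∸ i))   ≡⟨ Σ≤-suc n (λ i → f (suc n ∸ i)) ⟨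
  Σ≤ (suc n) (λ i → f (suc n ∸ i))     ∎

Σ≤-truncate : ∀ a c (f : ℕ → ℚ) → a ≤ c → (∀ {i} → a < i → i ≤ c → f i ≡ 0ℚ) → Σ≤ c f ≡ Σ≤ a f
Σ≤-truncate a zero    f z≤n f≡0 = refl
Σ≤-truncate a (suc c) f a≤c f≡0 with ℕ.m≤n⇒m<n∨m≡n a≤c
... | inj₂ refl  = refl
... | inj₁ a<1+c = begin
  Σ≤ c f + f (suc c)
    ≡⟨ cong₂ _+_ (Σ≤-truncate a c f (ℕ.≤-pred a<1+c) (λ a<i i≤c → f≡0 a<i (ℕ.m≤n⇒m≤1+n i≤c)))
                 (f≡0 a<1+c ℕ.≤-refl) ⟩
  Σ≤ a f + 0ℚ
    ≡⟨ ℚ.+-identityʳ (Σ≤ a f) ⟩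
  Σ≤ a f ∎

Σ≤-select : ∀ n k (f : ℕ → ℚ) → k ≤ n → (∀ {i} → i ≤ n → i ≢ k → f i ≡ 0ℚ) → Σ≤ n f ≡ f k
Σ≤-select zero    zero f z≤n f≡0 = refl
Σ≤-select (suc n) k    f k≤n f≡0 with ℕ.m≤n⇒m<n∨m≡n k≤n
... | inj₂ refl = begin
  Σ≤ n f + f (suc n)
    ≡⟨ cong (_+ f (suc n)) (Σ≤-zero n (λ i≤n → f≡0 (ℕ.m≤n⇒m≤1+n i≤n) (ℕ.<⇒≢ (s≤s i≤n)))) ⟩
  0ℚ + f (suc n)
    ≡⟨ ℚ.+-identityˡ (f (suc n)) ⟩
  f (suc n) ∎
... | inj₁ k<1+n = begin
  Σ≤ n f + f (suc n)
    ≡⟨ cong₂ _+_ (Σ≤-select n k f (ℕ.≤-pred k<1+n) (λ i≤n → f≡0 (ℕ.m≤n⇒m≤1+n i≤n)))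
                 (f≡0 ℕ.≤-refl (ℕ.>⇒≢ k<1+n)) ⟩
  f k + 0ℚ
    ≡⟨ ℚ.+-identityʳ (f k) ⟩
  f k ∎

uPow-≡ : ∀ k → uPow k k ≡ 1ℚ
uPow-≡ k with k ≡ᵇ k in eq
... | true  = refl
... | false = ⊥-elim (subst T eq (ℕ.≡⇒≡ᵇ k k refl))

uPow-≢ : ∀ {k i} → i ≢ k → uPow k i ≡ 0ℚ
uPow-≢ {k} {i} i≢k with i ≡ᵇ k in eq
... | true  = ⊥-elim (i≢k (ℕ.≡ᵇ⇒≡ i k (subst T (sym eq) _)))
... | false = refl

uPow-⊛ : ∀ k (g : Series) {n} → k ≤ n → (uPow k ⊛ g) n ≡ g (n ∸ k)
uPow-⊛ k g {n} k≤n = begin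
  Σ≤ n (λ i → uPow k i * g (n ∸ i))
    ≡⟨ Σ≤-select n k _ k≤n (λ {i} _ i≢k →
         trans (cong (_* g (n ∸ i)) (uPow-≢ i≢k)) (ℚ.*-zeroˡ (g (n ∸ i)))) ⟩
  uPow k k * g (n ∸ k)
    ≡⟨ cong (_* g (n ∸ k)) (uPow-≡ k) ⟩
  1ℚ * g (n ∸ k)
    ≡⟨ ℚ.*-identityˡ _ ⟩
  g (n ∸ k) ∎

uPow-⊛-< : ∀ k (g : Series) {n} → n < k → (uPow k ⊛ g) n ≡ 0ℚ
uPow-⊛-< k g {n} n<k = Σ≤-zero n (λ {i} i≤n →
  trans (cong (_* g (n ∸ i)) (uPow-≢ (ℕ.<⇒≢ (ℕ.≤-<-trans i≤n n<k)))) (ℚ.*-zeroˡ (g (n ∸ i))))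

⊛-comm : ∀ (f g : Series) n → (f ⊛ g) n ≡ (g ⊛ f) n
⊛-comm f g n = begin
  Σ≤ n (λ i → f i * g (n ∸ i))
    ≡⟨ Σ≤-reverse n _ ⟩
  Σ≤ n (λ i → f (n ∸ i) * g (n ∸ (n ∸ i)))
    ≡⟨ Σ≤-cong n (λ {i} i≤n →
         trans (cong (λ j → f (n ∸ i) * g j) (ℕ.m∸[m∸n]≡n i≤n)) (ℚ.*-comm (f (n ∸ i)) (g i))) ⟩
  Σ≤ n (λ i → g i * f (n ∸ i)) ∎

Σ≤-C-suc : ∀ N (z : ℕ → ℚ) → Σ≤ (suc N) (λ i → ℕ→ℚ (suc N C i) * z i)
                             ≡ Σ≤ N (λ i → ℕ→ℚ (N C i) * z i) + Σ≤ N (λ i → ℕ→ℚ (N C i) * z (suc i))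
Σ≤-C-suc N z = begin
  Σ≤ (suc N) (λ i → ℕ→ℚ (suc N C i) * z i)
    ≡⟨ Σ≤-suc N _ ⟩
  1ℚ * z 0 + Σ≤ N (λ i → ℕ→ℚ (suc N C suc i) * z (suc i))
    ≡⟨ cong (1ℚ * z 0 +_) (trans (Σ≤-cong N (λ {i} _ → pascal i)) (Σ≤-+ N _ _)) ⟩
  1ℚ * z 0 + (Σ≤ N (λ i → ℕ→ℚ (N C i) * z (suc i)) + Σ≤ N (λ i → ℕ→ℚ (N C suc i) * z (suc i)))
    ≡⟨ solve 3 (λ a b c → a :+ (b :+ c) := a :+ c :+ b) refl (1ℚ * z 0) _ _ ⟩
  1ℚ * z 0 + Σ≤ N (λ i → ℕ→ℚ (N C suc i) * z (suc i)) + Σ≤ N (λ i → ℕ→ℚ (N C i) * z (suc i))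
    ≡⟨ cong (_+ Σ≤ N (λ i → ℕ→ℚ (N C i) * z (suc i))) (Σ≤-suc N (λ i → ℕ→ℚ (N C i) * z i)) ⟨
  Σ≤ (suc N) (λ i → ℕ→ℚ (N C i) * z i) + Σ≤ N (λ i → ℕ→ℚ (N C i) * z (suc i))
    ≡⟨ cong (_+ Σ≤ N (λ i → ℕ→ℚ (N C i) * z (suc i))) (Σ≤-truncate N (suc N) _ (ℕ.n≤1+n N) top) ⟩
  Σ≤ N (λ i → ℕ→ℚ (N C i) * z i) + Σ≤ N (λ i → ℕ→ℚ (N C i) * z (suc i)) ∎
  where
  pascal : ∀ i → ℕ→ℚ (suc N C suc i) * z (suc i) ≡ ℕ→ℚ (N C i) * z (suc i) + ℕ→ℚ (N C suc i) * z (suc i)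
  pascal i = begin
    ℕ→ℚ (suc N C suc i) * z (suc i)
      ≡⟨ cong (λ c → ℕ→ℚ c * z (suc i)) (nCk+nC[k+1]≡[n+1]C[k+1] N i) ⟨
    ℕ→ℚ (N C i ℕ.+ N C suc i) * z (suc i)
      ≡⟨ cong (_* z (suc i)) (ℕ→ℚ-homo-+ (N C i) (N C suc i)) ⟩
    (ℕ→ℚ (N C i) + ℕ→ℚ (N C suc i)) * z (suc i)
      ≡⟨ ℚ.*-distribʳ-+ (z (suc i)) (ℕ→ℚ (N C i)) (ℕ→ℚ (N C suc i)) ⟩
    ℕ→ℚ (N C i) * z (suc i) + ℕ→ℚ (N C suc i) * z (suc i) ∎
  top : ∀ {i} → N < i → i ≤ suc N → ℕ→ℚ (N C i) * z i ≡ 0ℚ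
  top {i} N<i _ = trans (cong (λ c → ℕ→ℚ c * z i) (k>n⇒nCk≡0 N<i)) (ℚ.*-zeroˡ (z i))

hockey-stick : ∀ M j → Σ≤ j (λ i → ℕ→ℚ ((M ℕ.+ i) C i)) ≡ ℕ→ℚ ((suc M ℕ.+ j) C j)
hockey-stick M zero    = refl
hockey-stick M (suc j) = begin
  Σ≤ j (λ i → ℕ→ℚ ((M ℕ.+ i) C i)) + ℕ→ℚ ((M ℕ.+ suc j) C suc j)
    ≡⟨ cong₂ (λ x k → x + ℕ→ℚ (k C suc j)) (hockey-stick M j) (ℕ.+-suc M j) ⟩
  ℕ→ℚ ((suc M ℕ.+ j) C j) + ℕ→ℚ ((suc M ℕ.+ j) C suc j)
    ≡⟨ ℕ→ℚ-homo-+ ((suc M ℕ.+ j) C j) _ ⟨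
  ℕ→ℚ ((suc M ℕ.+ j) C j ℕ.+ (suc M ℕ.+ j) C suc j)
    ≡⟨ cong ℕ→ℚ (nCk+nC[k+1]≡[n+1]C[k+1] (suc M ℕ.+ j) j) ⟩
  ℕ→ℚ (suc (suc M ℕ.+ j) C suc j)
    ≡⟨ cong (λ k → ℕ→ℚ (suc k C suc j)) (ℕ.+-suc M j) ⟨
  ℕ→ℚ ((suc M ℕ.+ suc j) C suc j) ∎

invOneMinusPow-coeff : ∀ M j → invOneMinusPow (suc M) j ≡ ℕ→ℚ ((M ℕ.+ j) C j)
invOneMinusPow-coeff zero    j = begin
  (geom ⊛ uPow 0) j   ≡⟨ ⊛-comm geom (uPow 0) j ⟩
  (uPow 0 ⊛ geom) j   ≡⟨ uPow-⊛ 0 geom {j} z≤n ⟩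
  1ℚ                  ≡⟨ cong ℕ→ℚ (nCn≡1 j) ⟨
  ℕ→ℚ (j C j)         ∎
invOneMinusPow-coeff (suc M) j = begin
  (geom ⊛ invOneMinusPow (suc M)) j
    ≡⟨ ⊛-comm geom (invOneMinusPow (suc M)) j ⟩
  Σ≤ j (λ i → invOneMinusPow (suc M) i * 1ℚ)
    ≡⟨ Σ≤-cong j (λ {i} _ → trans (ℚ.*-identityʳ (invOneMinusPow (suc M) i)) (invOneMinusPow-coeff M i)) ⟩
  Σ≤ j (λ i → ℕ→ℚ ((M ℕ.+ i) C i))
    ≡⟨ hockey-stick M j ⟩
  ℕ→ℚ ((suc M ℕ.+ j) C j) ∎

rhsCoeff : ℕ → ℕ → ℕ → ℚ
rhsCoeff m n k = (uPow k ⊛ invOneMinusPow (m ℕ.+ k ℕ.+ 1)) n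

rhsCoeff≡C : ∀ m n k → k ≤ n → rhsCoeff m n k ≡ ℕ→ℚ ((m ℕ.+ n) C (n ∸ k))
rhsCoeff≡C m n k k≤n = begin
  (uPow k ⊛ invOneMinusPow (m ℕ.+ k ℕ.+ 1)) n
    ≡⟨ uPow-⊛ k (invOneMinusPow (m ℕ.+ k ℕ.+ 1)) k≤n ⟩
  invOneMinusPow (m ℕ.+ k ℕ.+ 1) (n ∸ k)
    ≡⟨ cong (λ N → invOneMinusPow N (n ∸ k)) (ℕ.+-comm (m ℕ.+ k) 1) ⟩
  invOneMinusPow (suc (m ℕ.+ k)) (n ∸ k)
    ≡⟨ invOneMinusPow-coeff (m ℕ.+ k) (n ∸ k) ⟩
  ℕ→ℚ ((m ℕ.+ k ℕ.+ (n ∸ k)) C (n ∸ k))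
    ≡⟨ cong (λ N → ℕ→ℚ (N C (n ∸ k)))
            (trans (ℕ.+-assoc m k (n ∸ k)) (cong (m ℕ.+_) (ℕ.m+[n∸m]≡n k≤n))) ⟩
  ℕ→ℚ ((m ℕ.+ n) C (n ∸ k)) ∎

rhsCoeff≡0 : ∀ m n k → n < k → rhsCoeff m n k ≡ 0ℚ
rhsCoeff≡0 m n k = uPow-⊛-< k (invOneMinusPow (m ℕ.+ k ℕ.+ 1))

-- δ n k is the coefficient of f (x + k) in (Δⁿ f)(x) / n!
δ : ℕ → ℕ → ℚ
δ n k = (- 1ℚ) ^ (n ∸ k) * (inv! k * inv! (n ∸ k))

δ-suc-∸ : ∀ n k → k ≤ n → δ (suc n) k * ℕ→ℚ (suc n ∸ k) ≡ - δ n k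
δ-suc-∸ n k k≤n = begin
  δ (suc n) k * ℕ→ℚ (suc n ∸ k)
    ≡⟨ cong (λ d → (- 1ℚ) ^ d * (inv! k * inv! d) * ℕ→ℚ d) (ℕ.+-∸-assoc 1 k≤n) ⟩
  (- 1ℚ) * (- 1ℚ) ^ (n ∸ k) * (inv! k * inv! (suc (n ∸ k))) * ℕ→ℚ (suc (n ∸ k))
    ≡⟨ solve 4 (λ s a b c → (:- con 1ℚ) :* s :* (a :* b) :* c := :- (s :* (a :* (b :* c)))) refl
             ((- 1ℚ) ^ (n ∸ k)) (inv! k) (inv! (suc (n ∸ k))) (ℕ→ℚ (suc (n ∸ k))) ⟩
  - ((- 1ℚ) ^ (n ∸ k) * (inv! k * (inv! (suc (n ∸ k)) * ℕ→ℚ (suc (n ∸ k)))))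
    ≡⟨ cong (λ c → - ((- 1ℚ) ^ (n ∸ k) * (inv! k * c))) (inv![1+n]*[1+n]≡inv!n (n ∸ k)) ⟩
  - δ n k ∎

δ-suc-suc : ∀ n k → δ (suc n) (suc k) * ℕ→ℚ (suc k) ≡ δ n k
δ-suc-suc n k = begin
  (- 1ℚ) ^ (n ∸ k) * (inv! (suc k) * inv! (n ∸ k)) * ℕ→ℚ (suc k)
    ≡⟨ solve 4 (λ s a b c → s :* (a :* b) :* c := s :* (a :* c :* b)) refl
             ((- 1ℚ) ^ (n ∸ k)) (inv! (suc k)) (inv! (n ∸ k)) (ℕ→ℚ (suc k)) ⟩
  (- 1ℚ) ^ (n ∸ k) * (inv! (suc k) * ℕ→ℚ (suc k) * inv! (n ∸ k))
    ≡⟨ cong (λ c → (- 1ℚ) ^ (n ∸ k) * (c * inv! (n ∸ k))) (inv![1+n]*[1+n]≡inv!n k) ⟩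
  δ n k ∎

Σ≤-[n∸k]*δ : ∀ n (f : ℕ → ℚ) →
             Σ≤ (suc n) (λ k → ℕ→ℚ (suc n ∸ k) * (f k * δ (suc n) k)) ≡ - Σ≤ n (λ k → f k * δ n k)
Σ≤-[n∸k]*δ n f = begin
  Σ≤ n (λ k → ℕ→ℚ (suc n ∸ k) * (f k * δ (suc n) k)) + ℕ→ℚ (suc n ∸ suc n) * last
    ≡⟨ cong₂ _+_ (Σ≤-cong n term) (trans (cong (λ d → ℕ→ℚ d * last) (ℕ.n∸n≡0 n)) (ℚ.*-zeroˡ last)) ⟩
  Σ≤ n (λ k → - (f k * δ n k)) + 0ℚ
    ≡⟨ trans (ℚ.+-identityʳ _) (Σ≤-neg n (λ k → f k * δ n k)) ⟩
  - Σ≤ n (λ k → f k * δ n k) ∎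
  where
  last : ℚ
  last = f (suc n) * δ (suc n) (suc n)
  term : ∀ {k} → k ≤ n → ℕ→ℚ (suc n ∸ k) * (f k * δ (suc n) k) ≡ - (f k * δ n k)
  term {k} k≤n = begin
    ℕ→ℚ (suc n ∸ k) * (f k * δ (suc n) k)
      ≡⟨ solve 3 (λ a b c → a :* (b :* c) := b :* (c :* a)) refl (ℕ→ℚ (suc n ∸ k)) (f k) (δ (suc n) k) ⟩
    f k * (δ (suc n) k * ℕ→ℚ (suc n ∸ k))
      ≡⟨ cong (f k *_) (δ-suc-∸ n k k≤n) ⟩
    f k * - δ n k
      ≡⟨ ℚ.neg-distribʳ-* (f k) (δ n k) ⟨
    - (f k * δ n k) ∎

Σ≤-k*δ : ∀ n (f : ℕ → ℚ) →
         Σ≤ (suc n) (λ k → ℕ→ℚ k * (f k * δ (suc n) k)) ≡ Σ≤ n (λ k → f (suc k) * δ n k)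
Σ≤-k*δ n f = begin
  Σ≤ (suc n) (λ k → ℕ→ℚ k * (f k * δ (suc n) k))
    ≡⟨ Σ≤-suc n _ ⟩
  0ℚ * (f 0 * δ (suc n) 0) + Σ≤ n (λ k → ℕ→ℚ (suc k) * (f (suc k) * δ (suc n) (suc k)))
    ≡⟨ cong₂ _+_ (ℚ.*-zeroˡ (f 0 * δ (suc n) 0)) (Σ≤-cong n (λ {k} _ → term k)) ⟩
  0ℚ + Σ≤ n (λ k → f (suc k) * δ n k)
    ≡⟨ ℚ.+-identityˡ _ ⟩
  Σ≤ n (λ k → f (suc k) * δ n k) ∎
  where
  term : ∀ k → ℕ→ℚ (suc k) * (f (suc k) * δ (suc n) (suc k)) ≡ f (suc k) * δ n k
  term k = trans (solve 3 (λ a b c → a :* (b :* c) := b :* (c :* a)) refl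
                          (ℕ→ℚ (suc k)) (f (suc k)) (δ (suc n) (suc k)))
                 (cong (f (suc k) *_) (δ-suc-suc n k))

-- Writing n + 1 = k + (n + 1 - k) in each term, the two weighted sums above cancel.
Σ≤-δ≡0 : ∀ n → Σ≤ (suc n) (δ (suc n)) ≡ 0ℚ
Σ≤-δ≡0 n = ℕ→ℚ[1+n]*y≡0⇒y≡0 n _ (begin
  ℕ→ℚ (suc n) * Σ≤ (suc n) (δ (suc n))
    ≡⟨ Σ≤-*ˡ (suc n) (ℕ→ℚ (suc n)) (δ (suc n)) ⟨
  Σ≤ (suc n) (λ k → ℕ→ℚ (suc n) * δ (suc n) k)
    ≡⟨ Σ≤-cong (suc n) split ⟩
  Σ≤ (suc n) (λ k → ℕ→ℚ k * (1ℚ * δ (suc n) k) + ℕ→ℚ (suc n ∸ k) * (1ℚ * δ (suc n) k))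
    ≡⟨ Σ≤-+ (suc n) _ _ ⟩
  Σ≤ (suc n) (λ k → ℕ→ℚ k * (1ℚ * δ (suc n) k))
    + Σ≤ (suc n) (λ k → ℕ→ℚ (suc n ∸ k) * (1ℚ * δ (suc n) k))
    ≡⟨ cong₂ _+_ (Σ≤-k*δ n (λ _ → 1ℚ)) (Σ≤-[n∸k]*δ n (λ _ → 1ℚ)) ⟩
  Σ≤ n (λ k → 1ℚ * δ n k) + - Σ≤ n (λ k → 1ℚ * δ n k)
    ≡⟨ ℚ.+-inverseʳ (Σ≤ n (λ k → 1ℚ * δ n k)) ⟩
  0ℚ ∎)
  where
  split : ∀ {k} → k ≤ suc n →
          ℕ→ℚ (suc n) * δ (suc n) k ≡ ℕ→ℚ k * (1ℚ * δ (suc n) k) + ℕ→ℚ (suc n ∸ k) * (1ℚ * δ (suc n) k)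
  split {k} k≤n = trans (cong (_* δ (suc n) k) (ℕ→ℚ-∸ k≤n))
                        (solve 3 (λ a b c → (a :+ b) :* c := a :* (con 1ℚ :* c) :+ b :* (con 1ℚ :* c)) refl
                               (ℕ→ℚ k) (ℕ→ℚ (suc n ∸ k)) (δ (suc n) k))

ℕ→ℚ-ind-+≡ᵇ : ∀ a b n →
              ℕ→ℚ (ind (a ℕ.+ b ≡ᵇ n)) ≡ Σ≤ n (λ s → ℕ→ℚ (ind ((a ≡ᵇ n ∸ s) ∧ (b ≡ᵇ s))))
ℕ→ℚ-ind-+≡ᵇ zero    zero    zero    = refl
ℕ→ℚ-ind-+≡ᵇ zero    (suc b) zero    = refl
ℕ→ℚ-ind-+≡ᵇ (suc a) b       zero    = refl
ℕ→ℚ-ind-+≡ᵇ a       zero    (suc n) = begin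
  ℕ→ℚ (ind (a ℕ.+ 0 ≡ᵇ suc n))
    ≡⟨ cong (λ c → ℕ→ℚ (ind (c ≡ᵇ suc n))) (ℕ.+-identityʳ a) ⟩
  ℕ→ℚ (ind (a ≡ᵇ suc n))
    ≡⟨ ℚ.+-identityʳ _ ⟨
  ℕ→ℚ (ind (a ≡ᵇ suc n)) + 0ℚ
    ≡⟨ cong₂ (λ c y → ℕ→ℚ (ind c) + y) (∧-identityʳ (a ≡ᵇ suc n))
             (Σ≤-zero n (λ {s} _ → cong (λ c → ℕ→ℚ (ind c)) (∧-zeroʳ (a ≡ᵇ n ∸ s)))) ⟨
  ℕ→ℚ (ind ((a ≡ᵇ suc n) ∧ true)) + Σ≤ n (λ s → ℕ→ℚ (ind ((a ≡ᵇ n ∸ s) ∧ false)))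
    ≡⟨ Σ≤-suc n _ ⟨
  Σ≤ (suc n) (λ s → ℕ→ℚ (ind ((a ≡ᵇ suc n ∸ s) ∧ (0 ≡ᵇ s)))) ∎
ℕ→ℚ-ind-+≡ᵇ a       (suc b) (suc n) = begin
  ℕ→ℚ (ind (a ℕ.+ suc b ≡ᵇ suc n))
    ≡⟨ cong (λ c → ℕ→ℚ (ind (c ≡ᵇ suc n))) (ℕ.+-suc a b) ⟩
  ℕ→ℚ (ind (a ℕ.+ b ≡ᵇ n))
    ≡⟨ ℕ→ℚ-ind-+≡ᵇ a b n ⟩
  Σ≤ n (λ s → ℕ→ℚ (ind ((a ≡ᵇ n ∸ s) ∧ (b ≡ᵇ s))))
    ≡⟨ ℚ.+-identityˡ _ ⟨
  0ℚ + Σ≤ n (λ s → ℕ→ℚ (ind ((a ≡ᵇ n ∸ s) ∧ (b ≡ᵇ s))))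
    ≡⟨ cong (λ c → ℕ→ℚ (ind c) + Σ≤ n (λ s → ℕ→ℚ (ind ((a ≡ᵇ n ∸ s) ∧ (b ≡ᵇ s)))))
            (∧-zeroʳ (a ≡ᵇ suc n)) ⟨
  ℕ→ℚ (ind ((a ≡ᵇ suc n) ∧ false)) + Σ≤ n (λ s → ℕ→ℚ (ind ((a ≡ᵇ n ∸ s) ∧ (b ≡ᵇ s))))
    ≡⟨ Σ≤-suc n _ ⟨
  Σ≤ (suc n) (λ s → ℕ→ℚ (ind ((a ≡ᵇ suc n ∸ s) ∧ (suc b ≡ᵇ s)))) ∎

ℕ→ℚ-count-length : ∀ n xs → All (All NonEmpty) xs →
  ℕ→ℚ (count (λ p → length p ≡ᵇ n) xs) ≡ Σ≤ n (λ s → ℕ→ℚ (count (hasShape (n ∸ s) s) xs))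
ℕ→ℚ-count-length n []       []         = sym (Σ≤-zero n (λ _ → refl))
ℕ→ℚ-count-length n (p ∷ xs) (ne ∷ nes) = begin
  ℕ→ℚ (ind (length p ≡ᵇ n) ℕ.+ count (λ p → length p ≡ᵇ n) xs)
    ≡⟨ ℕ→ℚ-homo-+ (ind (length p ≡ᵇ n)) _ ⟩
  ℕ→ℚ (ind (length p ≡ᵇ n)) + ℕ→ℚ (count (λ p → length p ≡ᵇ n) xs)
    ≡⟨ cong₂ _+_ (trans (cong (λ l → ℕ→ℚ (ind (l ≡ᵇ n))) (length≡#big+#singletons p ne))
                        (ℕ→ℚ-ind-+≡ᵇ (#big p) (#singletons p) n))
                 (ℕ→ℚ-count-length n xs nes) ⟩
  Σ≤ n (λ s → ℕ→ℚ (ind (hasShape (n ∸ s) s p))) + Σ≤ n (λ s → ℕ→ℚ (count (hasShape (n ∸ s) s) xs))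
    ≡⟨ Σ≤-+ n _ _ ⟨
  Σ≤ n (λ s → ℕ→ℚ (ind (hasShape (n ∸ s) s p)) + ℕ→ℚ (count (hasShape (n ∸ s) s) xs))
    ≡⟨ Σ≤-cong n (λ {s} _ → sym (ℕ→ℚ-homo-+ (ind (hasShape (n ∸ s) s p)) _)) ⟩
  Σ≤ n (λ s → ℕ→ℚ (count (hasShape (n ∸ s) s) (p ∷ xs))) ∎

stirling≡ΣC*S≥2 : ∀ j n →
                  ℕ→ℚ (stirling j n) ≡ Σ≤ n (λ s → ℕ→ℚ (j C s) * ℕ→ℚ (S≥2 (j ∸ s) (n ∸ s)))
stirling≡ΣC*S≥2 j n = trans (ℕ→ℚ-count-length n (partitions j) (partitions-nonEmpty j))
  (Σ≤-cong n (λ {s} _ → trans (cong ℕ→ℚ (closedForm j (n ∸ s) s)) (ℕ→ℚ-homo-* (j C s) _)))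

module _ (x : ℚ) where

  -- (Δⁿ f)(x) / n! for f y = y ^ N
  Δ : ℕ → ℕ → ℚ
  Δ N n = Σ≤ n (λ k → (x + ℕ→ℚ k) ^ N * δ n k)

  Δ-suc-zero : ∀ N → Δ (suc N) 0 ≡ x * Δ N 0
  Δ-suc-zero N = solve 3 (λ x a d → (x :+ con 0ℚ) :* a :* d := x :* (a :* d)) refl x ((x + 0ℚ) ^ N) (δ 0 0)

  Δ-zero-suc : ∀ n → Δ 0 (suc n) ≡ 0ℚ
  Δ-zero-suc n = trans (Σ≤-cong (suc n) (λ {k} _ → ℚ.*-identityˡ (δ (suc n) k))) (Σ≤-δ≡0 n)

  -- In (x + n + 1) Δ N (n + 1), split x + n + 1 = (x + k) + (n + 1 - k) in the k-th term.
  Δ-suc-suc : ∀ N n → Δ (suc N) (suc n) ≡ (x + ℕ→ℚ (suc n)) * Δ N (suc n) + Δ N n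
  Δ-suc-suc N n = begin
    Δ (suc N) (suc n)
      ≡⟨ solve 2 (λ a b → a := a :+ :- b :+ b) refl (Δ (suc N) (suc n)) (Δ N n) ⟩
    Δ (suc N) (suc n) + - Δ N n + Δ N n
      ≡⟨ cong₂ (λ a b → a + b + Δ N n)
               (Σ≤-cong (suc n) (λ {k} _ → sym (ℚ.*-assoc (x + ℕ→ℚ k) ((x + ℕ→ℚ k) ^ N) (δ (suc n) k))))
               (Σ≤-[n∸k]*δ n (λ k → (x + ℕ→ℚ k) ^ N)) ⟨
    Σ≤ (suc n) (λ k → (x + ℕ→ℚ k) * term k) + Σ≤ (suc n) (λ k → ℕ→ℚ (suc n ∸ k) * term k) + Δ N n
      ≡⟨ cong (_+ Δ N n) (Σ≤-+ (suc n) _ _) ⟨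
    Σ≤ (suc n) (λ k → (x + ℕ→ℚ k) * term k + ℕ→ℚ (suc n ∸ k) * term k) + Δ N n
      ≡⟨ cong (_+ Δ N n) (Σ≤-cong (suc n) split) ⟩
    Σ≤ (suc n) (λ k → (x + ℕ→ℚ (suc n)) * term k) + Δ N n
      ≡⟨ cong (_+ Δ N n) (Σ≤-*ˡ (suc n) (x + ℕ→ℚ (suc n)) term) ⟩
    (x + ℕ→ℚ (suc n)) * Δ N (suc n) + Δ N n ∎
    where
    term : ℕ → ℚ
    term k = (x + ℕ→ℚ k) ^ N * δ (suc n) k
    split : ∀ {k} → k ≤ suc n →
            (x + ℕ→ℚ k) * term k + ℕ→ℚ (suc n ∸ k) * term k ≡ (x + ℕ→ℚ (suc n)) * term k
    split {k} k≤n =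
      trans (solve 4 (λ x a b t → (x :+ a) :* t :+ b :* t := (x :+ (a :+ b)) :* t) refl
                     x (ℕ→ℚ k) (ℕ→ℚ (suc n ∸ k)) (term k))
            (cong (λ c → (x + c) * term k) (sym (ℕ→ℚ-∸ k≤n)))

  binomialTransform : (ℕ → ℚ) → ℕ → ℚ
  binomialTransform f N = Σ≤ N (λ i → ℕ→ℚ (N C i) * (x ^ i * f (N ∸ i)))

  binomialTransform-suc : ∀ f N →
    binomialTransform f (suc N) ≡ binomialTransform (λ j → f (suc j)) N + x * binomialTransform f N
  binomialTransform-suc f N = begin
    binomialTransform f (suc N)
      ≡⟨ Σ≤-C-suc N (λ i → x ^ i * f (suc N ∸ i)) ⟩
    Σ≤ N (λ i → ℕ→ℚ (N C i) * (x ^ i * f (suc N ∸ i))) + Σ≤ N (λ i → ℕ→ℚ (N C i) * (x ^ suc i * f (N ∸ i)))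
      ≡⟨ cong₂ _+_ (Σ≤-cong N (λ {i} i≤N → cong (λ j → ℕ→ℚ (N C i) * (x ^ i * f j)) (ℕ.+-∸-assoc 1 i≤N)))
                   (Σ≤-cong N (λ {i} _ → solve 4 (λ c x p y → c :* (x :* p :* y) := x :* (c :* (p :* y))) refl
                                                   (ℕ→ℚ (N C i)) x (x ^ i) (f (N ∸ i)))) ⟩
    binomialTransform (λ j → f (suc j)) N + Σ≤ N (λ i → x * (ℕ→ℚ (N C i) * (x ^ i * f (N ∸ i))))
      ≡⟨ cong (binomialTransform (λ j → f (suc j)) N +_) (Σ≤-*ˡ N x _) ⟩
    binomialTransform (λ j → f (suc j)) N + x * binomialTransform f N ∎

  binomialTransform-linear : ∀ N a (f g : ℕ → ℚ) →
    binomialTransform (λ j → f j + a * g j) N ≡ binomialTransform f N + a * binomialTransform g N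
  binomialTransform-linear N a f g = begin
    binomialTransform (λ j → f j + a * g j) N
      ≡⟨ Σ≤-cong N (λ {i} _ → solve 5 (λ c p y a z → c :* (p :* (y :+ a :* z)) := c :* (p :* y) :+ a :* (c :* (p :* z)))
                                       refl (ℕ→ℚ (N C i)) (x ^ i) (f (N ∸ i)) a (g (N ∸ i))) ⟩
    Σ≤ N (λ i → ℕ→ℚ (N C i) * (x ^ i * f (N ∸ i)) + a * (ℕ→ℚ (N C i) * (x ^ i * g (N ∸ i))))
      ≡⟨ Σ≤-+ N _ _ ⟩
    binomialTransform f N + Σ≤ N (λ i → a * (ℕ→ℚ (N C i) * (x ^ i * g (N ∸ i))))
      ≡⟨ cong (binomialTransform f N +_) (Σ≤-*ˡ N a _) ⟩
    binomialTransform f N + a * binomialTransform g N ∎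

  binomialTransform-zero : ∀ N (f : ℕ → ℚ) →
                           (∀ {i} → i ≤ N → f (N ∸ i) ≡ 0ℚ) → binomialTransform f N ≡ 0ℚ
  binomialTransform-zero N f f≡0 = Σ≤-zero N (λ {i} i≤N →
    trans (cong (λ y → ℕ→ℚ (N C i) * (x ^ i * y)) (f≡0 i≤N))
          (solve 2 (λ c p → c :* (p :* con 0ℚ) := con 0ℚ) refl (ℕ→ℚ (N C i)) (x ^ i)))

  stirlingPoly : ℕ → ℕ → ℚ
  stirlingPoly N n = binomialTransform (λ j → ℕ→ℚ (stirling j n)) N

  stirlingPoly-suc-zero : ∀ N → stirlingPoly (suc N) 0 ≡ x * stirlingPoly N 0
  stirlingPoly-suc-zero N = begin
    stirlingPoly (suc N) 0
      ≡⟨ binomialTransform-suc (λ j → ℕ→ℚ (stirling j 0)) N ⟩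
    binomialTransform (λ j → ℕ→ℚ (stirling (suc j) 0)) N + x * stirlingPoly N 0
      ≡⟨ cong (_+ x * stirlingPoly N 0)
              (binomialTransform-zero N (λ j → ℕ→ℚ (stirling (suc j) 0))
                                      (λ {i} _ → cong ℕ→ℚ (stirling-suc-zero (N ∸ i)))) ⟩
    0ℚ + x * stirlingPoly N 0
      ≡⟨ ℚ.+-identityˡ _ ⟩
    x * stirlingPoly N 0 ∎

  stirlingPoly-suc-suc : ∀ N n →
    stirlingPoly (suc N) (suc n) ≡ (x + ℕ→ℚ (suc n)) * stirlingPoly N (suc n) + stirlingPoly N n
  stirlingPoly-suc-suc N n = begin
    stirlingPoly (suc N) (suc n)
      ≡⟨ binomialTransform-suc (λ j → ℕ→ℚ (stirling j (suc n))) N ⟩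
    binomialTransform (λ j → ℕ→ℚ (stirling (suc j) (suc n))) N + x * stirlingPoly N (suc n)
      ≡⟨ cong (_+ x * stirlingPoly N (suc n))
              (Σ≤-cong N (λ {i} _ → cong (λ y → ℕ→ℚ (N C i) * (x ^ i * y)) (recurrence (N ∸ i)))) ⟩
    binomialTransform (λ j → ℕ→ℚ (stirling j n) + ℕ→ℚ (suc n) * ℕ→ℚ (stirling j (suc n))) N
      + x * stirlingPoly N (suc n)
      ≡⟨ cong (_+ x * stirlingPoly N (suc n))
              (binomialTransform-linear N (ℕ→ℚ (suc n)) (λ j → ℕ→ℚ (stirling j n))
                                                         (λ j → ℕ→ℚ (stirling j (suc n)))) ⟩
    stirlingPoly N n + ℕ→ℚ (suc n) * stirlingPoly N (suc n) + x * stirlingPoly N (suc n)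
      ≡⟨ solve 4 (λ a c b x → a :+ c :* b :+ x :* b := (x :+ c) :* b :+ a) refl
               (stirlingPoly N n) (ℕ→ℚ (suc n)) (stirlingPoly N (suc n)) x ⟩
    (x + ℕ→ℚ (suc n)) * stirlingPoly N (suc n) + stirlingPoly N n ∎
    where
    recurrence : ∀ j → ℕ→ℚ (stirling (suc j) (suc n))
                       ≡ ℕ→ℚ (stirling j n) + ℕ→ℚ (suc n) * ℕ→ℚ (stirling j (suc n))
    recurrence j = begin
      ℕ→ℚ (stirling (suc j) (suc n))
        ≡⟨ cong ℕ→ℚ (stirling-suc j n) ⟩
      ℕ→ℚ (stirling j n ℕ.+ suc n ℕ.* stirling j (suc n))
        ≡⟨ ℕ→ℚ-homo-+ (stirling j n) _ ⟩
      ℕ→ℚ (stirling j n) + ℕ→ℚ (suc n ℕ.* stirling j (suc n))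
        ≡⟨ cong (ℕ→ℚ (stirling j n) +_) (ℕ→ℚ-homo-* (suc n) (stirling j (suc n))) ⟩
      ℕ→ℚ (stirling j n) + ℕ→ℚ (suc n) * ℕ→ℚ (stirling j (suc n)) ∎

  Δ≡stirlingPoly : ∀ N n → Δ N n ≡ stirlingPoly N n
  Δ≡stirlingPoly zero    zero    = refl
  Δ≡stirlingPoly zero    (suc n) = Δ-zero-suc n
  Δ≡stirlingPoly (suc N) zero    = begin
    Δ (suc N) 0              ≡⟨ Δ-suc-zero N ⟩
    x * Δ N 0                ≡⟨ cong (x *_) (Δ≡stirlingPoly N 0) ⟩
    x * stirlingPoly N 0     ≡⟨ stirlingPoly-suc-zero N ⟨
    stirlingPoly (suc N) 0   ∎
  Δ≡stirlingPoly (suc N) (suc n) = begin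
    Δ (suc N) (suc n)
      ≡⟨ Δ-suc-suc N n ⟩
    (x + ℕ→ℚ (suc n)) * Δ N (suc n) + Δ N n
      ≡⟨ cong₂ (λ a b → (x + ℕ→ℚ (suc n)) * a + b) (Δ≡stirlingPoly N (suc n)) (Δ≡stirlingPoly N n) ⟩
    (x + ℕ→ℚ (suc n)) * stirlingPoly N (suc n) + stirlingPoly N n
      ≡⟨ stirlingPoly-suc-suc N n ⟨
    stirlingPoly (suc N) (suc n) ∎

  S≥2Poly : ℕ → ℕ → ℚ
  S≥2Poly M k = binomialTransform (λ a → ℕ→ℚ (S≥2 a k)) M

  stirlingPoly≡ΣC*S≥2Poly : ∀ N n → stirlingPoly N n ≡ Σ≤ n (λ s → ℕ→ℚ (N C s) * S≥2Poly (N ∸ s) (n ∸ s))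
  stirlingPoly≡ΣC*S≥2Poly N n = begin
    stirlingPoly N n
      ≡⟨ Σ≤-cong N (λ {i} _ → expand i) ⟩
    Σ≤ N (λ i → Σ≤ n (λ s → F i s))
      ≡⟨ Σ≤-swap N n F ⟩
    Σ≤ n (λ s → Σ≤ N (λ i → F i s))
      ≡⟨ Σ≤-cong n (λ {s} _ → trans (Σ≤-cong N (λ {i} _ → F≡C*G i s)) (Σ≤-*ˡ N (ℕ→ℚ (N C s)) (G s))) ⟩
    Σ≤ n (λ s → ℕ→ℚ (N C s) * Σ≤ N (G s))
      ≡⟨ Σ≤-cong n (λ {s} _ → cong (ℕ→ℚ (N C s) *_)
                                     (Σ≤-truncate (N ∸ s) N (G s) (ℕ.m∸n≤m N s) (λ N∸s<i _ → G≡0 s N∸s<i))) ⟩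
    Σ≤ n (λ s → ℕ→ℚ (N C s) * S≥2Poly (N ∸ s) (n ∸ s)) ∎
    where
    F : ℕ → ℕ → ℚ
    F i s = ℕ→ℚ (N C i) * (x ^ i * (ℕ→ℚ ((N ∸ i) C s) * ℕ→ℚ (S≥2 (N ∸ i ∸ s) (n ∸ s))))
    G : ℕ → ℕ → ℚ
    G s i = ℕ→ℚ ((N ∸ s) C i) * (x ^ i * ℕ→ℚ (S≥2 (N ∸ s ∸ i) (n ∸ s)))
    expand : ∀ i → ℕ→ℚ (N C i) * (x ^ i * ℕ→ℚ (stirling (N ∸ i) n)) ≡ Σ≤ n (F i)
    expand i = begin
      ℕ→ℚ (N C i) * (x ^ i * ℕ→ℚ (stirling (N ∸ i) n))
        ≡⟨ cong (λ y → ℕ→ℚ (N C i) * (x ^ i * y)) (stirling≡ΣC*S≥2 (N ∸ i) n) ⟩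
      ℕ→ℚ (N C i) * (x ^ i * Σ≤ n (λ s → ℕ→ℚ ((N ∸ i) C s) * ℕ→ℚ (S≥2 (N ∸ i ∸ s) (n ∸ s))))
        ≡⟨ cong (ℕ→ℚ (N C i) *_) (Σ≤-*ˡ n (x ^ i) _) ⟨
      ℕ→ℚ (N C i) * Σ≤ n (λ s → x ^ i * (ℕ→ℚ ((N ∸ i) C s) * ℕ→ℚ (S≥2 (N ∸ i ∸ s) (n ∸ s))))
        ≡⟨ Σ≤-*ˡ n (ℕ→ℚ (N C i)) _ ⟨
      Σ≤ n (F i) ∎
    F≡C*G : ∀ i s → F i s ≡ ℕ→ℚ (N C s) * G s i
    F≡C*G i s = begin
      ℕ→ℚ (N C i) * (x ^ i * (ℕ→ℚ ((N ∸ i) C s) * ℕ→ℚ (S≥2 (N ∸ i ∸ s) (n ∸ s))))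
        ≡⟨ solve 4 (λ a p b t → a :* (p :* (b :* t)) := a :* b :* (p :* t)) refl
                 (ℕ→ℚ (N C i)) (x ^ i) (ℕ→ℚ ((N ∸ i) C s)) (ℕ→ℚ (S≥2 (N ∸ i ∸ s) (n ∸ s))) ⟩
      ℕ→ℚ (N C i) * ℕ→ℚ ((N ∸ i) C s) * (x ^ i * ℕ→ℚ (S≥2 (N ∸ i ∸ s) (n ∸ s)))
        ≡⟨ cong₂ (λ c d → c * (x ^ i * ℕ→ℚ (S≥2 d (n ∸ s)))) trinomial (∸-comm N i s) ⟩
      ℕ→ℚ (N C s) * ℕ→ℚ ((N ∸ s) C i) * (x ^ i * ℕ→ℚ (S≥2 (N ∸ s ∸ i) (n ∸ s)))
        ≡⟨ ℚ.*-assoc (ℕ→ℚ (N C s)) _ _ ⟩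
      ℕ→ℚ (N C s) * G s i ∎
      where
      trinomial : ℕ→ℚ (N C i) * ℕ→ℚ ((N ∸ i) C s) ≡ ℕ→ℚ (N C s) * ℕ→ℚ ((N ∸ s) C i)
      trinomial = trans (sym (ℕ→ℚ-homo-* (N C i) _))
                        (trans (cong ℕ→ℚ (nCi*[n∸i]Cs≡nCs*[n∸s]Ci N i s)) (ℕ→ℚ-homo-* (N C s) _))
    G≡0 : ∀ s {i} → N ∸ s < i → G s i ≡ 0ℚ
    G≡0 s {i} N∸s<i =
      trans (cong (λ c → ℕ→ℚ c * (x ^ i * ℕ→ℚ (S≥2 (N ∸ s ∸ i) (n ∸ s)))) (k>n⇒nCk≡0 N∸s<i))
            (ℚ.*-zeroˡ (x ^ i * ℕ→ℚ (S≥2 (N ∸ s ∸ i) (n ∸ s))))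

  S≥2Poly≡0 : ∀ m k → m < k → S≥2Poly (m ℕ.+ k) k ≡ 0ℚ
  S≥2Poly≡0 m k m<k = binomialTransform-zero (m ℕ.+ k) (λ a → ℕ→ℚ (S≥2 a k)) (λ {i} _ →
    cong ℕ→ℚ (n<k+k⇒S≥2≡0 _ k (ℕ.≤-<-trans (ℕ.m∸n≤m (m ℕ.+ k) i) (ℕ.+-monoˡ-< k m<k))))

  lhs≡Δ : ∀ m n → lhs m x n ≡ Δ (m ℕ.+ n) n
  lhs≡Δ m n = Σ≤-cong n term
    where
    term : ∀ {k} → k ≤ n →
           ((x + ℕ→ℚ k) ^ (m ℕ.+ k) * inv! k) * (uPow k ⊛ expNeg (x + ℕ→ℚ k)) n
             ≡ (x + ℕ→ℚ k) ^ (m ℕ.+ n) * δ n k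
    term {k} k≤n = begin
      (a ^ (m ℕ.+ k) * inv! k) * (uPow k ⊛ expNeg a) n
        ≡⟨ cong (a ^ (m ℕ.+ k) * inv! k *_) (uPow-⊛ k (expNeg a) k≤n) ⟩
      (a ^ (m ℕ.+ k) * inv! k) * ((- 1ℚ) ^ (n ∸ k) * a ^ (n ∸ k) * inv! (n ∸ k))
        ≡⟨ solve 5 (λ p i s q j → (p :* i) :* (s :* q :* j) := (p :* q) :* (s :* (i :* j))) refl
                 (a ^ (m ℕ.+ k)) (inv! k) ((- 1ℚ) ^ (n ∸ k)) (a ^ (n ∸ k)) (inv! (n ∸ k)) ⟩
      a ^ (m ℕ.+ k) * a ^ (n ∸ k) * δ n k
        ≡⟨ cong (_* δ n k) (^-+ a (m ℕ.+ k) (n ∸ k)) ⟨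
      a ^ (m ℕ.+ k ℕ.+ (n ∸ k)) * δ n k
        ≡⟨ cong (λ N → a ^ N * δ n k) (trans (ℕ.+-assoc m k (n ∸ k)) (cong (m ℕ.+_) (ℕ.m+[n∸m]≡n k≤n))) ⟩
      a ^ (m ℕ.+ n) * δ n k ∎
      where
      a : ℚ
      a = x + ℕ→ℚ k

  -- The terms with i > m - k vanish because then m + k - i < 2k.
  rhs≡ΣS≥2Poly : ∀ m n → rhs m x n ≡ Σ≤ m (λ k → rhsCoeff m n k * S≥2Poly (m ℕ.+ k) k)
  rhs≡ΣS≥2Poly m n = Σ≤-cong m term
    where
    term : ∀ {k} → k ≤ m →
      Σ≤ (m ∸ k) (λ i → (ℕ→ℚ ((m ℕ.+ k) C i) * ℕ→ℚ (S≥2 (m ℕ.+ k ∸ i) k) * x ^ i) * rhsCoeff m n k)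
        ≡ rhsCoeff m n k * S≥2Poly (m ℕ.+ k) k
    term {k} k≤m = begin
      Σ≤ (m ∸ k) (λ i → (ℕ→ℚ ((m ℕ.+ k) C i) * ℕ→ℚ (S≥2 (m ℕ.+ k ∸ i) k) * x ^ i) * c)
        ≡⟨ Σ≤-cong (m ∸ k) (λ {i} _ → solve 4 (λ b s p c → b :* s :* p :* c := c :* (b :* (p :* s))) refl
                                               (ℕ→ℚ ((m ℕ.+ k) C i)) (ℕ→ℚ (S≥2 (m ℕ.+ k ∸ i) k)) (x ^ i) c) ⟩
      Σ≤ (m ∸ k) (λ i → c * g i)
        ≡⟨ Σ≤-*ˡ (m ∸ k) c g ⟩
      c * Σ≤ (m ∸ k) g
        ≡⟨ cong (c *_) (Σ≤-truncate (m ∸ k) (m ℕ.+ k) g (ℕ.≤-trans (ℕ.m∸n≤m m k) (ℕ.m≤m+n m k)) g≡0) ⟨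
      c * S≥2Poly (m ℕ.+ k) k ∎
      where
      c : ℚ
      c = rhsCoeff m n k
      g : ℕ → ℚ
      g i = ℕ→ℚ ((m ℕ.+ k) C i) * (x ^ i * ℕ→ℚ (S≥2 (m ℕ.+ k ∸ i) k))
      g≡0 : ∀ {i} → m ∸ k < i → i ≤ m ℕ.+ k → g i ≡ 0ℚ
      g≡0 {i} m∸k<i i≤m+k =
        trans (cong (λ y → ℕ→ℚ ((m ℕ.+ k) C i) * (x ^ i * ℕ→ℚ y))
                    (n<k+k⇒S≥2≡0 _ k (m+k∸i<k+k k≤m m∸k<i i≤m+k)))
              (solve 2 (λ b p → b :* (p :* con 0ℚ) := con 0ℚ) refl (ℕ→ℚ ((m ℕ.+ k) C i)) (x ^ i))

  -- Substituting k = n - s; the terms with k > n or k > m vanish.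
  stirlingPoly≡ΣS≥2Poly : ∀ m n → stirlingPoly (m ℕ.+ n) n ≡ Σ≤ m (λ k → rhsCoeff m n k * S≥2Poly (m ℕ.+ k) k)
  stirlingPoly≡ΣS≥2Poly m n = begin
    stirlingPoly (m ℕ.+ n) n
      ≡⟨ stirlingPoly≡ΣC*S≥2Poly (m ℕ.+ n) n ⟩
    Σ≤ n (λ s → ℕ→ℚ ((m ℕ.+ n) C s) * S≥2Poly (m ℕ.+ n ∸ s) (n ∸ s))
      ≡⟨ Σ≤-reverse n _ ⟩
    Σ≤ n (λ k → ℕ→ℚ ((m ℕ.+ n) C (n ∸ k)) * S≥2Poly (m ℕ.+ n ∸ (n ∸ k)) (n ∸ (n ∸ k)))
      ≡⟨ Σ≤-cong n reindex ⟩
    Σ≤ n term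
      ≡⟨ Σ≤-truncate n (m ℕ.+ n) term (ℕ.m≤n+m n m)
                     (λ {k} n<k _ → trans (cong (_* S≥2Poly (m ℕ.+ k) k) (rhsCoeff≡0 m n k n<k))
                                          (ℚ.*-zeroˡ (S≥2Poly (m ℕ.+ k) k))) ⟨
    Σ≤ (m ℕ.+ n) term
      ≡⟨ Σ≤-truncate m (m ℕ.+ n) term (ℕ.m≤m+n m n)
                     (λ {k} m<k _ → trans (cong (rhsCoeff m n k *_) (S≥2Poly≡0 m k m<k)) (ℚ.*-zeroʳ (rhsCoeff m n k))) ⟩
    Σ≤ m term ∎
    where
    term : ℕ → ℚ
    term k = rhsCoeff m n k * S≥2Poly (m ℕ.+ k) k
    reindex : ∀ {k} → k ≤ n →
              ℕ→ℚ ((m ℕ.+ n) C (n ∸ k)) * S≥2Poly (m ℕ.+ n ∸ (n ∸ k)) (n ∸ (n ∸ k)) ≡ term k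
    reindex {k} k≤n =
      trans (cong₂ (λ M j → ℕ→ℚ ((m ℕ.+ n) C (n ∸ k)) * S≥2Poly M j) m+n∸[n∸k]≡m+k (ℕ.m∸[m∸n]≡n k≤n))
            (cong (_* S≥2Poly (m ℕ.+ k) k) (sym (rhsCoeff≡C m n k k≤n)))
      where
      m+n∸[n∸k]≡m+k : m ℕ.+ n ∸ (n ∸ k) ≡ m ℕ.+ k
      m+n∸[n∸k]≡m+k = trans (ℕ.+-∸-assoc m (ℕ.m∸n≤m n k)) (cong (m ℕ.+_) (ℕ.m∸[m∸n]≡n k≤n))

theorem1p1 : (m : ℕ) (x : ℚ) (n : ℕ) → lhs m x n ≡ rhs m x n
theorem1p1 m x n = begin
  lhs m x n                                                ≡⟨ lhs≡Δ x m n ⟩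
  Δ x (m ℕ.+ n) n                                          ≡⟨ Δ≡stirlingPoly x (m ℕ.+ n) n ⟩
  stirlingPoly x (m ℕ.+ n) n                               ≡⟨ stirlingPoly≡ΣS≥2Poly x m n ⟩
  Σ≤ m (λ k → rhsCoeff m n k * S≥2Poly x (m ℕ.+ k) k)      ≡⟨ rhs≡ΣS≥2Poly x m n ⟨
  rhs m x n                                                ∎
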